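{- Let $p$ be a prime, $n\ge1$, $r\ge0$, $x=(x_0,\dots,x_{n-1})\in\mathbb{F}_p{}^n$ and $y\in\mathbb{F}_p$. The following are minimal polynomial expressions: \[ \operatorname{ismax}(y;x)=\sum_{t=0}^{p-1}\delta_t(y)\sum_{i=0}^{n-1}\Bigl(\prod_{j<i}L_t(x_j)\cdot\delta_t(x_i)\cdot\prod_{k>i}L_{t+1}(x_k)\Bigr), \] \[ \mathrm{nummax}^{(0)}(x)=\sum_{i=0}^{n-1}\chi(\max(x)=x_i)=\sum_{i=0}^{n-1}\sum_{0\le t\le p-1}\Bigl(\delta_t(x_i)\prod_{j\ne i}L_{t+1}(x_j)\Bigr), \] \[ \mathrm{nummax}^{(r)}(x)=\sum_{k=1}^{n}k^{(r)}\cdot\chi\bigl(\#\{i\mid \max(x)=x_i\}=k\bigr)=\sum_{k=1}^{n}k^{(r)}\Bigl(\sum_{I}\sum_{0\le t\le p-1}\prod_{i\in I}\delta_t(x_i)\prod_{j\notin I}L_t(x_j)\Bigr), \] where in the last formula $I$ ranges over all $k$-element subsets of $\{0,1,\dots,n-1\}$ and $j$ over $\{0,\dots,n-1\}\setminus I$; all indices $j,k$ in the products range over $\{0,\dots,n-1\}$.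
   Context: $\mathbb{F}_p$ is identified with $\{0,1,\dots,p-1\}$ with the usual ordering; $\max(x)$ is the largest of $x_0,\dots,x_{n-1}$. $\chi(P)$ is $1$ if $P$ holds and $0$ otherwise. $\operatorname{ismax}(y;x)=\chi(\max(x)=y)$. For an integer $m\ge0$, $m^{(r)}$ is its $r$-th base-$p$ digit viewed in $\mathbb{F}_p$, and $\mathrm{nummax}^{(r)}(x)$ is the $r$-th base-$p$ digit of the number of indices $i$ with $x_i=\max(x)$. For $t\in\mathbb{F}_p$, $\delta_t(x)=1-(x-t)^{p-1}$; for an integer $0\le t\le p$, $L_t(x)=\sum_{0\le k<t}(1-(x-k)^{p-1})$ (the minimal polynomial of $\chi(x<t)$). A minimal polynomial expression is a polynomial over $\mathbb{F}_p$ of degree at most $p-1$ in each variable coinciding with the function on all inputs. -}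

module Defs where

open import Data.Nat using (ℕ; zero; suc; _+_; _*_; _∸_; _≤_; NonZero)
open import Data.Nat.DivMod using (_mod_; _/_)
import Data.Nat as ℕ
open import Data.Fin using (Fin; zero; suc; toℕ; _<?_)
import Data.Fin as F
open import Data.Fin.Subset using (Subset; ∣_∣; outside; inside)
open import Data.Fin.Subset.Properties using (_∈?_)
open import Data.Vec using (Vec; []; _∷_; replicate; tabulate; zipWith; lookup)
open import Data.Vec.Properties using (≡-dec)
open import Data.List using (List; []; _∷_; _++_; map; concatMap; foldr; filter; upTo; allFin; length)
open import Data.Product using (_×_; _,_; Σ)
open import Data.Bool using (if_then_else_)
open import Relation.Nullary using (Dec; yes; no; ¬_)
open import Relation.Nullary.Decidable using (⌊_⌋)
open import Relation.Binary.PropositionalEquality using (_≡_)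
open import Function using (_∘_)

module _ (p : ℕ) .{{_ : NonZero p}} where

  Fp : Set
  Fp = Fin p

  ⟦_⟧ : ℕ → Fp
  ⟦ k ⟧ = k mod p

  0F 1F : Fp
  0F = ⟦ 0 ⟧
  1F = ⟦ 1 ⟧

  _+F_ _*F_ : Fp → Fp → Fp
  a +F b = ⟦ toℕ a + toℕ b ⟧
  a *F b = ⟦ toℕ a * toℕ b ⟧

  -F_ : Fp → Fp
  -F a = ⟦ p ∸ toℕ a ⟧

  χ : {P : Set} → Dec P → Fp
  χ (yes _) = 1F
  χ (no _)  = 0F

  sumF : {A : Set} → List A → (A → Fp) → Fp
  sumF xs f = foldr (λ a s → f a +F s) 0F xs

  data Expr (m : ℕ) : Set where
    cst  : Fp → Expr m
    var  : Fin m → Expr m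
    _⊕_  : Expr m → Expr m → Expr m
    _⊗_  : Expr m → Expr m → Expr m
    ⊖_   : Expr m → Expr m

  eval : {m : ℕ} → Expr m → (Fin m → Fp) → Fp
  eval (cst c) ρ = c
  eval (var i) ρ = ρ i
  eval (e ⊕ f) ρ = eval e ρ +F eval f ρ
  eval (e ⊗ f) ρ = eval e ρ *F eval f ρ
  eval (⊖ e)   ρ = -F (eval e ρ)

  -- formal expansion into a list of monomials (coefficient, exponent vector)
  expand : {m : ℕ} → Expr m → List (Fp × Vec ℕ m)
  expand {m} (cst c) = (c , replicate m 0) ∷ []
  expand (var i) = (1F , tabulate (λ j → if ⌊ i F.≟ j ⌋ then 1 else 0)) ∷ []
  expand (e ⊕ f) = expand e ++ expand f
  expand (e ⊗ f) = concatMap (λ { (a , u) → map (λ { (b , v) → (a *F b , zipWith _+_ u v) }) (expand f) }) (expand e)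
  expand (⊖ e) = map (λ { (a , u) → (-F a , u) }) (expand e)

  coeff : {m : ℕ} → Expr m → Vec ℕ m → Fp
  coeff E ex = sumF (expand E) (λ { (a , u) → if ⌊ ≡-dec ℕ._≟_ u ex ⌋ then a else 0F })

  Reduced : {m : ℕ} → Expr m → Set
  Reduced {m} E = (ex : Vec ℕ m) (i : Fin m) → p ≤ lookup ex i → coeff E ex ≡ 0F

  IsMinimalPolyExpr : {m : ℕ} → Expr m → ((Fin m → Fp) → Fp) → Set
  IsMinimalPolyExpr E f = ((ρ : Fin _ → Fp) → eval E ρ ≡ f ρ) × Reduced E

  ΣE : {m : ℕ} {A : Set} → List A → (A → Expr m) → Expr m
  ΣE xs f = foldr (λ a s → f a ⊕ s) (cst 0F) xs

  ΠE : {m : ℕ} {A : Set} → List A → (A → Expr m) → Expr m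
  ΠE xs f = foldr (λ a s → f a ⊗ s) (cst 1F) xs

  powE : {m : ℕ} → Expr m → ℕ → Expr m
  powE e zero = cst 1F
  powE e (suc k) = e ⊗ powE e k

  δ : {m : ℕ} → Fp → Expr m → Expr m
  δ t x = cst 1F ⊕ (⊖ powE (x ⊕ (⊖ cst t)) (p ∸ 1))

  L : {m : ℕ} → ℕ → Expr m → Expr m
  L t x = ΣE (upTo t) (λ k → δ ⟦ k ⟧ x)

  maxF : Fp → Fp → Fp
  maxF a b = if ⌊ toℕ a ℕ.≤? toℕ b ⌋ then b else a

  maxAll : {n : ℕ} → (Fin (suc n) → Fp) → Fp
  maxAll {zero} x = x zero
  maxAll {suc n} x = maxF (x zero) (maxAll (x ∘ suc))

  ismax : {n : ℕ} → Fp → (Fin (suc n) → Fp) → Fp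
  ismax y x = χ (maxAll x F.≟ y)

  numMaxCount : {n : ℕ} → (Fin (suc n) → Fp) → ℕ
  numMaxCount x = length (filter (λ i → x i F.≟ maxAll x) (allFin _))

  -- r-th base-p digit of m, viewed in F_p
  digit : ℕ → ℕ → Fp
  digit zero m = ⟦ m ⟧
  digit (suc r) m = digit r (m / p)

  nummax : {n : ℕ} → ℕ → (Fin (suc n) → Fp) → Fp
  nummax r x = digit r (numMaxCount x)

  tRange : List ℕ
  tRange = upTo p

  -- variables: zero ↦ y, suc i ↦ x_i
  ismaxExpr : (n : ℕ) → Expr (suc n)
  ismaxExpr n =
    ΣE tRange λ t → δ ⟦ t ⟧ (var zero) ⊗
      ΣE (allFin n) λ i →
        (ΠE (filter (λ j → j <? i) (allFin n)) (λ j → L t (var (suc j)))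
          ⊗ δ ⟦ t ⟧ (var (suc i)))
          ⊗ ΠE (filter (λ k → i <? k) (allFin n)) (λ k → L (suc t) (var (suc k)))

  nummax0Expr : (n : ℕ) → Expr n
  nummax0Expr n =
    ΣE (allFin n) λ i → ΣE tRange λ t →
      δ ⟦ t ⟧ (var i) ⊗ ΠE (filter (λ j → ¬? (j F.≟ i)) (allFin n)) (λ j → L (suc t) (var j))
    where
      ¬? : {P : Set} → Dec P → Dec (¬ P)
      ¬? (yes q) = no (λ f → f q)
      ¬? (no q) = yes q

  allSubsets : (n : ℕ) → List (Subset n)
  allSubsets zero = [] ∷ []
  allSubsets (suc n) = map (outside ∷_) (allSubsets n) ++ map (inside ∷_) (allSubsets n)

  subsetsOfSize : (n k : ℕ) → List (Subset n)
  subsetsOfSize n k = filter (λ I → ∣ I ∣ ℕ.≟ k) (allSubsets n)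

  nummaxExpr : (n r : ℕ) → Expr n
  nummaxExpr n r =
    ΣE (map suc (upTo n)) λ k → cst (digit r k) ⊗
      (ΣE (subsetsOfSize n k) λ I → ΣE tRange λ t →
        ΠE (filter (λ i → i ∈? I) (allFin n)) (λ i → δ ⟦ t ⟧ (var i))
          ⊗ ΠE (filter (λ j → ¬? (j ∈? I)) (allFin n)) (λ j → L t (var j)))
    where
      ¬? : {P : Set} → Dec P → Dec (¬ P)
      ¬? (yes q) = no (λ f → f q)
      ¬? (no q) = yes q

-- The factors δ_t(x) = 1 - (x - t)^(p-1) and L_t(x) = Σ_{k<t} δ_k(x) evaluate,
-- by Fermat's little theorem, to the indicators [x = t] and [x < t]. So each of the three
-- expressions evaluates to the residue of a natural number built from indicators, and the
-- claims become counting identities: for fixed t the i-th summand of the ismax formula is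
-- the indicator that i is the leftmost index at which the maximum t is attained; in the
-- nummax^(0) formula the sum over t singles out [x_i = max x]; and in the nummax^(r)
-- formula the (I, t) summand is 1 exactly when t = max x and I is the set of maximal
-- indices. Minimality holds because in every product each variable occurs in at most one
-- factor, which has degree p - 1 in it.
module Submission where

open import Data.Bool using (Bool; true; false; if_then_else_)
import Data.Bool.Properties as Bool
open import Data.Fin using (Fin; zero; suc; toℕ)
import Data.Fin as F
open import Data.Fin.Properties using (toℕ<n; toℕ-inject₁; toℕ-fromℕ; toℕ-fromℕ<; toℕ-injective; all?)
open import Data.Fin.Subset using (Subset; inside; outside; ∣_∣; Nonempty) renaming (_∈_ to _∈ₛ_)
open import Data.Fin.Subset.Properties using (_∈?_; ⊆-antisym; nonempty?; Empty-unique; ∣⊥∣≡0)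
open import Data.List using (List; []; _∷_; _++_; map; filter; length; upTo; allFin)
open import Data.List.Membership.Propositional using () renaming (_∈_ to _∈ˡ_)
open import Data.List.Membership.Propositional.Properties using (∈-upTo⁻; ∈-filter⁻; ∈-filter⁺; ∈-allFin; ∈-map⁻)
open import Data.List.Properties using (map-tabulate; map-upTo; length-filter; length-tabulate)
open import Data.List.Relation.Unary.All as All using (All; []; _∷_)
open import Data.List.Relation.Unary.All.Properties using (++⁺; map⁺; concat⁺)
open import Data.List.Relation.Unary.Any using (here; there)
open import Data.Nat
import Data.Nat as ℕ
open import Data.Nat.Combinatorics using (_C_; nC1≡n; nCn≡1; nCk+nC[k+1]≡[n+1]C[k+1])
open import Data.Nat.DivMod
open import Data.Nat.Divisibility
open import Data.Nat.Primality using (Prime; euclidsLemma; prime⇒nonTrivial)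
open import Data.Nat.Properties
open import Data.Nat.Tactic.RingSolver using (solve-∀)
open import Algebra.Properties.CommutativeSemigroup *-commutativeSemigroup using (x∙yz≈y∙xz)
import Algebra.Properties.CommutativeSemiring.Binomial +-*-commutativeSemiring as Binomial
open import Algebra.Properties.Semiring.Sum +-*-semiring using (sum; sum-cong-≗; sum-init-last)
import Algebra.Definitions.RawMonoid +-0-rawMonoid as Monoid
import Algebra.Definitions.RawSemiring +-*-rawSemiring as Semiring
open import Data.Product using (_×_; _,_; proj₁; proj₂; ∃)
open import Data.Sum using (inj₁; inj₂)
import Data.Vec as Vec
open import Data.Vec.Functional using (init; last)
open import Data.Vec.Properties
  using (lookup∘tabulate; []=⇒lookup; lookup⇒[]=; ∷-injectiveˡ; ∷-injectiveʳ; ≡-dec; lookup-replicate; lookup-zipWith)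
open import Defs
open import Function using (_∘_; _⇔_; mk⇔; Equivalence)
import Function.Properties.Equivalence as ⇔
open import Relation.Binary using (tri<; tri≈; tri>)
open import Relation.Binary.PropositionalEquality hiding ([_])
open import Relation.Nullary using (¬_; Dec; yes; no; does; _because_; contradiction; _×-dec_; _→-dec_)
open import Relation.Nullary.Decidable using (dec-true; dec-false; does-⇔; decidable-stable; isYes≗does; ⌊_⌋)

-- Fermat's little theorem

C-absorption : ∀ n k → suc k * (suc n C suc k) ≡ suc n * (n C k)
C-absorption zero zero = refl
C-absorption zero (suc k) = *-zeroʳ (2 + k)
C-absorption (suc n) zero = trans (*-identityˡ _) (trans (nC1≡n (2 + n)) (sym (*-identityʳ (2 + n))))
C-absorption (suc n) (suc k) = begin
  (2 + k) * ((2 + n) C (2 + k))            ≡⟨ cong ((2 + k) *_) (nCk+nC[k+1]≡[n+1]C[k+1] (1 + n) (1 + k)) ⟨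
  (2 + k) * (A + (1 + n) C (2 + k))        ≡⟨ *-distribˡ-+ (2 + k) A _ ⟩
  (A + (1 + k) * A) + (2 + k) * ((1 + n) C (2 + k))
    ≡⟨ cong₂ (λ u v → (A + u) + v) (C-absorption n k) (C-absorption n (suc k)) ⟩
  (A + (1 + n) * (n C k)) + (1 + n) * (n C (1 + k))
    ≡⟨ +-assoc A _ _ ⟩
  A + ((1 + n) * (n C k) + (1 + n) * (n C (1 + k)))
    ≡⟨ cong (A +_) (sym (*-distribˡ-+ (1 + n) (n C k) _)) ⟩
  A + (1 + n) * (n C k + n C (1 + k))      ≡⟨ cong (λ u → A + (1 + n) * u) (nCk+nC[k+1]≡[n+1]C[k+1] n k) ⟩
  (2 + n) * A                              ∎
  where
  open ≡-Reasoning
  A = (1 + n) C (1 + k)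

prime∣C : ∀ {p k} → Prime p → 0 < k → k < p → p ∣ p C k
prime∣C {suc q} {suc k} pr _ k<p
  with euclidsLemma (suc k) (suc q C suc k) pr (divides (q C k) (trans (C-absorption q k) (*-comm (suc q) _)))
... | inj₁ p∣k = contradiction (∣⇒≤ p∣k) (<⇒≱ k<p)
... | inj₂ p∣C = p∣C

×≡* : ∀ m n → m Monoid.× n ≡ m * n
×≡* zero n = refl
×≡* (suc m) n = cong (n +_) (×≡* m n)

^≡^ : ∀ a n → a Semiring.^ n ≡ a ^ n
^≡^ a zero = refl
^≡^ a (suc n) = cong (a *_) (^≡^ a n)

binomial-theorem : ∀ a n → (a + 1) ^ n ≡ sum (λ (k : Fin (suc n)) → (n C toℕ k) * a ^ toℕ k)
binomial-theorem a n = begin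
  (a + 1) ^ n                       ≡⟨ ^≡^ (a + 1) n ⟨
  (a + 1) Semiring.^ n              ≡⟨ Binomial.theorem n a 1 ⟩
  Binomial.binomialExpansion a 1 n  ≡⟨ sum-cong-≗ term ⟩
  sum (λ (k : Fin (suc n)) → (n C toℕ k) * a ^ toℕ k) ∎
  where
  open ≡-Reasoning
  term : ∀ k → Binomial.binomialTerm a 1 n k ≡ (n C toℕ k) * a ^ toℕ k
  term k = begin
    (n C toℕ k) Monoid.× (a Semiring.^ toℕ k * 1 Semiring.^ (n ∸ toℕ k))
      ≡⟨ ×≡* (n C toℕ k) _ ⟩
    (n C toℕ k) * (a Semiring.^ toℕ k * 1 Semiring.^ (n ∸ toℕ k))
      ≡⟨ cong₂ (λ u v → (n C toℕ k) * (u * v)) (^≡^ a (toℕ k))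
               (trans (^≡^ 1 (n ∸ toℕ k)) (^-zeroˡ (n ∸ toℕ k))) ⟩
    (n C toℕ k) * (a ^ toℕ k * 1)   ≡⟨ cong ((n C toℕ k) *_) (*-identityʳ (a ^ toℕ k)) ⟩
    (n C toℕ k) * a ^ toℕ k         ∎

∣-sum : ∀ {d n} (f : Fin n → ℕ) → (∀ i → d ∣ f i) → d ∣ sum f
∣-sum {n = zero} f _ = _ ∣0
∣-sum {n = suc n} f d∣f = ∣m∣n⇒∣m+n (d∣f zero) (∣-sum (f ∘ suc) (d∣f ∘ suc))

-- Only the two outer binomial coefficients survive modulo p.
freshman's-dream : ∀ {p} .{{_ : NonZero p}} → Prime p → ∀ a → (a + 1) ^ p % p ≡ (a ^ p + 1) % p
freshman's-dream {suc q} pr a = begin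
  (a + 1) ^ suc q % suc q            ≡⟨ cong (_% suc q) (binomial-theorem a (suc q)) ⟩
  (1 + sum inner) % suc q            ≡⟨ cong (λ s → (1 + s) % suc q) (sum-init-last inner) ⟩
  (1 + (sum (init inner) + last inner)) % suc q
    ≡⟨ cong (λ s → (1 + (sum (init inner) + s)) % suc q) last≡ ⟩
  (1 + (sum (init inner) + a ^ suc q)) % suc q
    ≡⟨ cong (_% suc q) (trans (+-comm 1 _) (+-assoc (sum (init inner)) _ 1)) ⟩
  (sum (init inner) + (a ^ suc q + 1)) % suc q
    ≡⟨ %-remove-+ˡ (a ^ suc q + 1) (∣-sum (init inner) middle) ⟩
  (a ^ suc q + 1) % suc q             ∎
  where
  open ≡-Reasoning
  inner : Fin (suc q) → ℕ
  inner k = (suc q C suc (toℕ k)) * a ^ suc (toℕ k)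
  last≡ : last inner ≡ a ^ suc q
  last≡ rewrite toℕ-fromℕ q = trans (cong (_* a ^ suc q) (nCn≡1 (suc q))) (*-identityˡ _)
  middle : ∀ i → suc q ∣ init inner i
  middle i = ∣m⇒∣m*n _ (prime∣C pr z<s (s<s (subst (_< q) (sym (toℕ-inject₁ i)) (toℕ<n i))))

fermat-little : ∀ {p} .{{_ : NonZero p}} → Prime p → ∀ a → a ^ p % p ≡ a % p
fermat-little {suc q} pr zero = refl
fermat-little {p@(suc q)} pr (suc a) = begin
  (1 + a) ^ p % p          ≡⟨ cong (λ b → b ^ p % p) (+-comm 1 a) ⟩
  (a + 1) ^ p % p          ≡⟨ freshman's-dream pr a ⟩
  (a ^ p + 1) % p          ≡⟨ %-distribˡ-+ (a ^ p) 1 p ⟩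
  (a ^ p % p + 1 % p) % p  ≡⟨ cong (λ b → (b + 1 % p) % p) (fermat-little pr a) ⟩
  (a % p + 1 % p) % p      ≡⟨ %-distribˡ-+ a 1 p ⟨
  (a + 1) % p              ≡⟨ cong (_% p) (+-comm a 1) ⟩
  (1 + a) % p              ∎
  where open ≡-Reasoning

[m+n]%d≡m%d⇒d∣n : ∀ {m n d} .{{_ : NonZero d}} → (m + n) % d ≡ m % d → d ∣ n
[m+n]%d≡m%d⇒d∣n {m} {n} {d} eq = ∣m+n∣m⇒∣n (divides ((m + n) / d) quotients) (n∣m*n (m / d))
  where
  open ≡-Reasoning
  quotients : (m / d) * d + n ≡ ((m + n) / d) * d
  quotients = +-cancelˡ-≡ (m % d) _ _ (begin
    m % d + ((m / d) * d + n)  ≡⟨ +-assoc (m % d) _ n ⟨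
    (m % d + (m / d) * d) + n  ≡⟨ cong (_+ n) (m≡m%n+[m/n]*n m d) ⟨
    m + n                      ≡⟨ m≡m%n+[m/n]*n (m + n) d ⟩
    (m + n) % d + ((m + n) / d) * d ≡⟨ cong (_+ ((m + n) / d) * d) eq ⟩
    m % d + ((m + n) / d) * d  ∎)

-- Writing a ^ (p - 1) = 1 + e, Fermat's little theorem says a * e ≡ 0, so p ∣ e.
fermat : ∀ {p} .{{_ : NonZero p}} → Prime p → ∀ {a} → ¬ p ∣ a → a ^ (p ∸ 1) % p ≡ 1
fermat {p@(suc q)} pr {a} p∤a with a ^ q in a^q≡
... | zero = contradiction (subst (p ∣_) (sym (m^n≡0⇒m≡0 a q a^q≡)) (p ∣0)) p∤a
... | suc e with euclidsLemma a e pr ([m+n]%d≡m%d⇒d∣n {a} (begin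
      (a + a * e) % p   ≡⟨ cong (_% p) (*-suc a e) ⟨
      a * suc e % p     ≡⟨ cong (λ b → a * b % p) a^q≡ ⟨
      a ^ p % p         ≡⟨ fermat-little pr a ⟩
      a % p             ∎))
  where open ≡-Reasoning
... | inj₁ p∣a = contradiction p∣a p∤a
... | inj₂ p∣e = trans (%-remove-+ʳ 1 p∣e) (m<n⇒m%n≡m (nonTrivial⇒n>1 p {{prime⇒nonTrivial pr}}))

-- Indicators, sums and products

𝟙 : {P : Set} → Dec P → ℕ
𝟙 d = if does d then 1 else 0

𝟙-yes : {P : Set} (d : Dec P) → P → 𝟙 d ≡ 1
𝟙-yes d x rewrite dec-true d x = refl

𝟙-no : {P : Set} (d : Dec P) → ¬ P → 𝟙 d ≡ 0
𝟙-no d ¬x rewrite dec-false d ¬x = refl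

𝟙≤1 : {P : Set} (d : Dec P) → 𝟙 d ≤ 1
𝟙≤1 (true because _) = ≤-refl
𝟙≤1 (false because _) = z≤n

𝟙-cong : {P Q : Set} → P ⇔ Q → (d : Dec P) (e : Dec Q) → 𝟙 d ≡ 𝟙 e
𝟙-cong P⇔Q d e = cong (λ b → if b then 1 else 0) (does-⇔ P⇔Q d e)

𝟙-×-dec : {P Q : Set} (d : Dec P) (e : Dec Q) → 𝟙 d * 𝟙 e ≡ 𝟙 (d ×-dec e)
𝟙-×-dec (true because _) e = +-identityʳ (𝟙 e)
𝟙-×-dec (false because _) e = refl

𝟙-→-dec : {P Q : Set} (d : Dec P) (e : Dec Q) → (if does d then 𝟙 e else 1) ≡ 𝟙 (d →-dec e)
𝟙-→-dec (true because _) e = refl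
𝟙-→-dec (false because _) e = refl

𝟙-trichotomy : ∀ {n} (i w : Fin n) → 𝟙 (w F.<? i) + 𝟙 (i F.≟ w) + 𝟙 (i F.<? w) ≡ 1
𝟙-trichotomy i w with Data.Fin.Properties.<-cmp w i
... | tri< w<i w≢i i≮w rewrite 𝟙-yes (w F.<? i) w<i | 𝟙-no (i F.≟ w) (w≢i ∘ sym) | 𝟙-no (i F.<? w) i≮w = refl
... | tri≈ w≮w refl _ rewrite 𝟙-no (w F.<? w) w≮w | 𝟙-yes (w F.≟ w) refl = refl
... | tri> w≮i w≢i i<w rewrite 𝟙-no (w F.<? i) w≮i | 𝟙-no (i F.≟ w) (w≢i ∘ sym) | 𝟙-yes (i F.<? w) i<w = refl

module _ {A : Set} where

  ∑ ∏ : List A → (A → ℕ) → ℕ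
  ∑ [] f = 0
  ∑ (a ∷ xs) f = f a + ∑ xs f
  ∏ [] f = 1
  ∏ (a ∷ xs) f = f a * ∏ xs f

  ∑-cong : ∀ xs {f g : A → ℕ} → (∀ {a} → a ∈ˡ xs → f a ≡ g a) → ∑ xs f ≡ ∑ xs g
  ∑-cong [] eq = refl
  ∑-cong (a ∷ xs) eq = cong₂ _+_ (eq (here refl)) (∑-cong xs (eq ∘ there))

  ∏-cong : ∀ xs {f g : A → ℕ} → (∀ a → f a ≡ g a) → ∏ xs f ≡ ∏ xs g
  ∏-cong [] eq = refl
  ∏-cong (a ∷ xs) eq = cong₂ _*_ (eq a) (∏-cong xs eq)

  ∑-zero : ∀ xs {f : A → ℕ} → (∀ a → f a ≡ 0) → ∑ xs f ≡ 0
  ∑-zero [] eq = refl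
  ∑-zero (a ∷ xs) eq = cong₂ _+_ (eq a) (∑-zero xs eq)

  ∏-one : ∀ xs {f : A → ℕ} → (∀ a → f a ≡ 1) → ∏ xs f ≡ 1
  ∏-one [] eq = refl
  ∏-one (a ∷ xs) eq = cong₂ _*_ (eq a) (∏-one xs eq)

  ∑-++ : ∀ xs ys (f : A → ℕ) → ∑ (xs ++ ys) f ≡ ∑ xs f + ∑ ys f
  ∑-++ [] ys f = refl
  ∑-++ (a ∷ xs) ys f = trans (cong (f a +_) (∑-++ xs ys f)) (sym (+-assoc (f a) _ _))

  ∑-*ˡ : ∀ xs c (f : A → ℕ) → ∑ xs (λ a → c * f a) ≡ c * ∑ xs f
  ∑-*ˡ [] c f = sym (*-zeroʳ c)
  ∑-*ˡ (a ∷ xs) c f = trans (cong (c * f a +_) (∑-*ˡ xs c f)) (sym (*-distribˡ-+ c (f a) _))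

  ∏-* : ∀ xs (f g : A → ℕ) → ∏ xs f * ∏ xs g ≡ ∏ xs (λ a → f a * g a)
  ∏-* [] f g = refl
  ∏-* (a ∷ xs) f g = begin
    (f a * ∏ xs f) * (g a * ∏ xs g)   ≡⟨ *-assoc (f a) _ _ ⟩
    f a * (∏ xs f * (g a * ∏ xs g))   ≡⟨ cong (f a *_) (x∙yz≈y∙xz (∏ xs f) (g a) _) ⟩
    f a * (g a * (∏ xs f * ∏ xs g))   ≡⟨ *-assoc (f a) (g a) _ ⟨
    (f a * g a) * (∏ xs f * ∏ xs g)   ≡⟨ cong (f a * g a *_) (∏-* xs f g) ⟩
    (f a * g a) * ∏ xs (λ b → f b * g b) ∎
    where open ≡-Reasoning

  ∑-filter : ∀ {P : A → Set} (P? : ∀ a → Dec (P a)) xs (f : A → ℕ) →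
             ∑ (filter P? xs) f ≡ ∑ xs (λ a → 𝟙 (P? a) * f a)
  ∑-filter P? [] f = refl
  ∑-filter P? (a ∷ xs) f with does (P? a)
  ... | true = cong₂ _+_ (sym (+-identityʳ (f a))) (∑-filter P? xs f)
  ... | false = ∑-filter P? xs f

  ∏-filter : ∀ {P : A → Set} (P? : ∀ a → Dec (P a)) xs (f : A → ℕ) →
             ∏ (filter P? xs) f ≡ ∏ xs (λ a → if does (P? a) then f a else 1)
  ∏-filter P? [] f = refl
  ∏-filter P? (a ∷ xs) f with does (P? a)
  ... | true = cong (f a *_) (∏-filter P? xs f)
  ... | false = trans (∏-filter P? xs f) (sym (+-identityʳ _))

  ∏-filter-ones : ∀ {P : A → Set} (P? : ∀ a → Dec (P a)) xs (f : A → ℕ) →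
                  (∀ a → ¬ P a → f a ≡ 1) → ∏ (filter P? xs) f ≡ ∏ xs f
  ∏-filter-ones P? [] f ones = refl
  ∏-filter-ones P? (a ∷ xs) f ones with P? a
  ... | yes _ = cong (f a *_) (∏-filter-ones P? xs f ones)
  ... | no ¬Pa = trans (∏-filter-ones P? xs f ones)
                       (trans (sym (+-identityʳ _)) (cong (_* ∏ xs f) (sym (ones a ¬Pa))))

  length-filter≡∑𝟙 : ∀ {P : A → Set} (P? : ∀ a → Dec (P a)) xs → length (filter P? xs) ≡ ∑ xs (𝟙 ∘ P?)
  length-filter≡∑𝟙 P? [] = refl
  length-filter≡∑𝟙 P? (a ∷ xs) with does (P? a)
  ... | true = cong suc (length-filter≡∑𝟙 P? xs)
  ... | false = length-filter≡∑𝟙 P? xs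

∑-map : ∀ {A B : Set} (g : A → B) xs (f : B → ℕ) → ∑ (map g xs) f ≡ ∑ xs (f ∘ g)
∑-map g [] f = refl
∑-map g (a ∷ xs) f = cong (f (g a) +_) (∑-map g xs f)

∏-map : ∀ {A B : Set} (g : A → B) xs (f : B → ℕ) → ∏ (map g xs) f ≡ ∏ xs (f ∘ g)
∏-map g [] f = refl
∏-map g (a ∷ xs) f = cong (f (g a) *_) (∏-map g xs f)

∑-allFin-suc : ∀ n (f : Fin (suc n) → ℕ) → ∑ (allFin (suc n)) f ≡ f zero + ∑ (allFin n) (f ∘ suc)
∑-allFin-suc n f =
  cong (f zero +_) (trans (cong (λ xs → ∑ xs f) (sym (map-tabulate (λ i → i) suc))) (∑-map suc (allFin n) f))

∏-allFin-suc : ∀ n (f : Fin (suc n) → ℕ) → ∏ (allFin (suc n)) f ≡ f zero * ∏ (allFin n) (f ∘ suc)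
∏-allFin-suc n f =
  cong (f zero *_) (trans (cong (λ xs → ∏ xs f) (sym (map-tabulate (λ i → i) suc))) (∏-map suc (allFin n) f))

∑-upTo-suc : ∀ T (f : ℕ → ℕ) → ∑ (upTo (suc T)) f ≡ f 0 + ∑ (upTo T) (f ∘ suc)
∑-upTo-suc T f = cong (f 0 +_) (trans (cong (λ xs → ∑ xs f) (sym (map-upTo suc T))) (∑-map suc (upTo T) f))

sift : ∀ T c (f : ℕ → ℕ) → ∑ (upTo T) (λ t → 𝟙 (c ≟ t) * f t) ≡ 𝟙 (c <? T) * f c
sift zero c f = refl
sift (suc T) zero f = begin
  ∑ (upTo (suc T)) (λ t → 𝟙 (0 ≟ t) * f t)  ≡⟨ ∑-upTo-suc T _ ⟩
  1 * f 0 + ∑ (upTo T) (λ _ → 0)            ≡⟨ cong (1 * f 0 +_) (∑-zero (upTo T) λ _ → refl) ⟩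
  1 * f 0 + 0                                ≡⟨ +-identityʳ _ ⟩
  1 * f 0                                    ∎
  where open ≡-Reasoning
sift (suc T) (suc c) f = trans (∑-upTo-suc T (λ t → 𝟙 (suc c ≟ t) * f t)) (sift T c (f ∘ suc))

sift-< : ∀ {T c} (f : ℕ → ℕ) → c < T → ∑ (upTo T) (λ t → 𝟙 (c ≟ t) * f t) ≡ f c
sift-< {T} {c} f c<T = trans (sift T c f) (trans (cong (_* f c) (𝟙-yes (c <? T) c<T)) (*-identityˡ (f c)))

sift-suc : ∀ N (g : ℕ → ℕ) {c} → 1 ≤ c → c ≤ N → ∑ (map suc (upTo N)) (λ k → g k * 𝟙 (c ≟ k)) ≡ g c
sift-suc N g {suc c} _ c<N = begin
  ∑ (map suc (upTo N)) (λ k → g k * 𝟙 (suc c ≟ k))  ≡⟨ ∑-map suc (upTo N) _ ⟩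
  ∑ (upTo N) (λ k → g (suc k) * 𝟙 (c ≟ k))          ≡⟨ ∑-cong (upTo N) (λ _ → *-comm (g (suc _)) _) ⟩
  ∑ (upTo N) (λ k → 𝟙 (c ≟ k) * g (suc k))          ≡⟨ sift-< (g ∘ suc) c<N ⟩
  g (suc c)                                          ∎
  where open ≡-Reasoning

sift-Fin : ∀ {n} (w : Fin n) (f : Fin n → ℕ) → ∑ (allFin n) (λ j → 𝟙 (j F.≟ w) * f j) ≡ f w
sift-Fin {suc n} zero f = begin
  ∑ (allFin (suc n)) (λ j → 𝟙 (j F.≟ zero) * f j)  ≡⟨ ∑-allFin-suc n (λ j → 𝟙 (j F.≟ zero) * f j) ⟩
  1 * f zero + ∑ (allFin n) (λ _ → 0)               ≡⟨ cong (1 * f zero +_) (∑-zero (allFin n) λ _ → refl) ⟩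
  1 * f zero + 0                                     ≡⟨ trans (+-identityʳ _) (*-identityˡ _) ⟩
  f zero                                             ∎
  where open ≡-Reasoning
sift-Fin {suc n} (suc w) f = trans (∑-allFin-suc n (λ j → 𝟙 (j F.≟ suc w) * f j)) (sift-Fin w (f ∘ suc))

∑-filter-𝟙≟ : ∀ {n} {P : Fin n → Set} (P? : ∀ j → Dec (P j)) w →
              ∑ (filter P? (allFin n)) (λ j → 𝟙 (j F.≟ w)) ≡ 𝟙 (P? w)
∑-filter-𝟙≟ {n} P? w = begin
  ∑ (filter P? (allFin n)) (λ j → 𝟙 (j F.≟ w))        ≡⟨ ∑-filter P? (allFin n) _ ⟩
  ∑ (allFin n) (λ j → 𝟙 (P? j) * 𝟙 (j F.≟ w))         ≡⟨ ∑-cong (allFin n) (λ {j} _ → *-comm (𝟙 (P? j)) _) ⟩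
  ∑ (allFin n) (λ j → 𝟙 (j F.≟ w) * 𝟙 (P? j))         ≡⟨ sift-Fin w (𝟙 ∘ P?) ⟩
  𝟙 (P? w)                                             ∎
  where open ≡-Reasoning

∏-𝟙 : ∀ n {P : Fin n → Set} (d : ∀ i → Dec (P i)) → ∏ (allFin n) (𝟙 ∘ d) ≡ 𝟙 (all? d)
∏-𝟙 zero d = refl
∏-𝟙 (suc n) {P} d = begin
  ∏ (allFin (suc n)) (𝟙 ∘ d)                 ≡⟨ ∏-allFin-suc n (𝟙 ∘ d) ⟩
  𝟙 (d zero) * ∏ (allFin n) (𝟙 ∘ d ∘ suc)    ≡⟨ cong (𝟙 (d zero) *_) (∏-𝟙 n (λ i → d (suc i))) ⟩
  𝟙 (d zero) * 𝟙 (all? (λ i → d (suc i)))    ≡⟨ 𝟙-×-dec (d zero) (all? (λ i → d (suc i))) ⟩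
  𝟙 (d zero ×-dec all? (λ i → d (suc i)))
    ≡⟨ 𝟙-cong (mk⇔ cons uncons) (d zero ×-dec all? (λ i → d (suc i))) (all? d) ⟩
  𝟙 (all? d)                                 ∎
  where
  open ≡-Reasoning
  cons : P zero × (∀ i → P (suc i)) → ∀ i → P i
  cons (x , xs) zero = x
  cons (x , xs) (suc i) = xs i
  uncons : (∀ i → P i) → P zero × (∀ i → P (suc i))
  uncons xs = xs zero , xs ∘ suc

-- Maxima of finite sequences

⨆ : ∀ {n} → (Fin (suc n) → ℕ) → ℕ
⨆ {zero} v = v zero
⨆ {suc n} v = v zero ⊔ ⨆ (v ∘ suc)

≤-⨆ : ∀ {n} (v : Fin (suc n) → ℕ) i → v i ≤ ⨆ v
≤-⨆ {zero} v zero = ≤-refl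
≤-⨆ {suc n} v zero = m≤m⊔n (v zero) _
≤-⨆ {suc n} v (suc i) = ≤-trans (≤-⨆ (v ∘ suc) i) (m≤n⊔m (v zero) _)

⨆-attained : ∀ {n} (v : Fin (suc n) → ℕ) → ∃ λ i → v i ≡ ⨆ v
⨆-attained {zero} v = zero , refl
⨆-attained {suc n} v with ⊔-sel (v zero) (⨆ (v ∘ suc))
... | inj₁ ⊔≡v₀ = zero , sym ⊔≡v₀
... | inj₂ ⊔≡⨆ with ⨆-attained (v ∘ suc)
...   | i , vᵢ≡⨆ = suc i , trans vᵢ≡⨆ (sym ⊔≡⨆)

⨆<⇔ : ∀ {n} (v : Fin (suc n) → ℕ) c → ⨆ v < c ⇔ (∀ i → v i < c)
⨆<⇔ v c = mk⇔ (λ ⨆<c i → ≤-<-trans (≤-⨆ v i) ⨆<c)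
              (λ v<c → let (i , vᵢ≡⨆) = ⨆-attained v in subst (_< c) vᵢ≡⨆ (v<c i))

∏-<-⨆ : ∀ {n} (v : Fin (suc n) → ℕ) c → ∏ (allFin (suc n)) (λ j → 𝟙 (v j <? c)) ≡ 𝟙 (⨆ v <? c)
∏-<-⨆ {n} v c = trans (∏-𝟙 (suc n) (λ j → v j <? c))
                      (𝟙-cong (⇔.sym (⨆<⇔ v c)) (all? (λ j → v j <? c)) (⨆ v <? c))

𝟙-⊔≟ : ∀ a b t → 𝟙 (a ≟ t) * 𝟙 (b <? suc t) + 𝟙 (a <? t) * 𝟙 (b ≟ t) ≡ 𝟙 (a ⊔ b ≟ t)
𝟙-⊔≟ a b t with <-cmp a t
... | tri< a<t a≢t _ = begin
  𝟙 (a ≟ t) * 𝟙 (b <? suc t) + 𝟙 (a <? t) * 𝟙 (b ≟ t)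
    ≡⟨ cong₂ (λ x y → x * 𝟙 (b <? suc t) + y * 𝟙 (b ≟ t)) (𝟙-no (a ≟ t) a≢t) (𝟙-yes (a <? t) a<t) ⟩
  1 * 𝟙 (b ≟ t)       ≡⟨ *-identityˡ _ ⟩
  𝟙 (b ≟ t)           ≡⟨ 𝟙-cong (mk⇔ b≡t⇒ ⇒b≡t) (b ≟ t) (a ⊔ b ≟ t) ⟩
  𝟙 (a ⊔ b ≟ t)       ∎
  where
  open ≡-Reasoning
  b≡t⇒ : b ≡ t → a ⊔ b ≡ t
  b≡t⇒ refl = m≤n⇒m⊔n≡n (<⇒≤ a<t)
  ⇒b≡t : a ⊔ b ≡ t → b ≡ t
  ⇒b≡t a⊔b≡t with ⊔-sel a b
  ... | inj₁ a⊔b≡a = contradiction (trans (sym a⊔b≡a) a⊔b≡t) a≢t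
  ... | inj₂ a⊔b≡b = trans (sym a⊔b≡b) a⊔b≡t
... | tri≈ _ refl a≮a = begin
  𝟙 (a ≟ a) * 𝟙 (b <? suc a) + 𝟙 (a <? a) * 𝟙 (b ≟ a)
    ≡⟨ cong₂ (λ x y → x * 𝟙 (b <? suc a) + y * 𝟙 (b ≟ a)) (𝟙-yes (a ≟ a) refl) (𝟙-no (a <? a) a≮a) ⟩
  1 * 𝟙 (b <? suc a) + 0  ≡⟨ trans (+-identityʳ _) (*-identityˡ _) ⟩
  𝟙 (b <? suc a)
    ≡⟨ 𝟙-cong (mk⇔ (m≥n⇒m⊔n≡m ∘ s≤s⁻¹) (λ a⊔b≡a → s≤s (subst (b ≤_) a⊔b≡a (m≤n⊔m a b)))) (b <? suc a) (a ⊔ b ≟ a) ⟩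
  𝟙 (a ⊔ b ≟ a)           ∎
  where open ≡-Reasoning
... | tri> _ a≢t t<a = begin
  𝟙 (a ≟ t) * 𝟙 (b <? suc t) + 𝟙 (a <? t) * 𝟙 (b ≟ t)
    ≡⟨ cong₂ (λ x y → x * 𝟙 (b <? suc t) + y * 𝟙 (b ≟ t)) (𝟙-no (a ≟ t) a≢t) (𝟙-no (a <? t) (<⇒≯ t<a)) ⟩
  0                       ≡⟨ 𝟙-no (a ⊔ b ≟ t) (λ a⊔b≡t → <⇒≱ t<a (subst (a ≤_) a⊔b≡t (m≤m⊔n a b))) ⟨
  𝟙 (a ⊔ b ≟ t)           ∎
  where open ≡-Reasoning

-- The indicator that i is the leftmost index with v i ≡ t and no entry exceeds t; the
-- filtered products of the paper's formula are written as full products over an `if`.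
leftmostMax : ∀ {m} → (Fin m → ℕ) → ℕ → Fin m → ℕ
leftmostMax {m} v t i =
  (∏ (allFin m) (λ j → if does (j F.<? i) then 𝟙 (v j <? t) else 1) * 𝟙 (v i ≟ t))
    * ∏ (allFin m) (λ k → if does (i F.<? k) then 𝟙 (v k <? suc t) else 1)

∑-leftmostMax : ∀ {n} (v : Fin (suc n) → ℕ) t → ∑ (allFin (suc n)) (leftmostMax v t) ≡ 𝟙 (⨆ v ≟ t)
∑-leftmostMax {zero} v t = trans (+-identityʳ _) (trans (*-identityʳ _) (*-identityˡ _))
∑-leftmostMax {suc n} v t = begin
  ∑ (allFin (2 + n)) (leftmostMax v t)
    ≡⟨ ∑-allFin-suc (suc n) (leftmostMax v t) ⟩
  leftmostMax v t zero + ∑ (allFin (suc n)) (leftmostMax v t ∘ suc)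
    ≡⟨ cong₂ _+_ at-zero (trans (∑-cong (allFin (suc n)) (λ {i} _ → at-suc i))
                                (∑-*ˡ (allFin (suc n)) (𝟙 (v zero <? t)) (leftmostMax v′ t))) ⟩
  𝟙 (v zero ≟ t) * 𝟙 (⨆ v′ <? suc t) + 𝟙 (v zero <? t) * ∑ (allFin (suc n)) (leftmostMax v′ t)
    ≡⟨ cong (λ s → 𝟙 (v zero ≟ t) * 𝟙 (⨆ v′ <? suc t) + 𝟙 (v zero <? t) * s) (∑-leftmostMax v′ t) ⟩
  𝟙 (v zero ≟ t) * 𝟙 (⨆ v′ <? suc t) + 𝟙 (v zero <? t) * 𝟙 (⨆ v′ ≟ t)
    ≡⟨ 𝟙-⊔≟ (v zero) (⨆ v′) t ⟩
  𝟙 (⨆ v ≟ t) ∎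
  where
  open ≡-Reasoning
  v′ = v ∘ suc
  before after : Fin (2 + n) → Fin (2 + n) → ℕ
  before i j = if does (j F.<? i) then 𝟙 (v j <? t) else 1
  after i k = if does (i F.<? k) then 𝟙 (v k <? suc t) else 1
  drop-ones : ∀ b c → (1 * b) * (1 * c) ≡ b * c
  drop-ones = solve-∀
  regroup : ∀ x a b c → ((x * a) * b) * (1 * c) ≡ x * ((a * b) * c)
  regroup = solve-∀
  -- Below, the guards j <? zero, zero <? suc k and suc j <? suc i are decided by computation.
  at-zero : leftmostMax v t zero ≡ 𝟙 (v zero ≟ t) * 𝟙 (⨆ v′ <? suc t)
  at-zero = begin
    leftmostMax v t zero
      ≡⟨ cong₂ (λ x y → (x * 𝟙 (v zero ≟ t)) * y) (∏-one (allFin (2 + n)) {before zero} λ _ → refl)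
                                                  (∏-allFin-suc (suc n) (after zero)) ⟩
    (1 * 𝟙 (v zero ≟ t)) * (1 * ∏ (allFin (suc n)) (λ k → 𝟙 (v′ k <? suc t)))
      ≡⟨ drop-ones (𝟙 (v zero ≟ t)) (∏ (allFin (suc n)) (λ k → 𝟙 (v′ k <? suc t))) ⟩
    𝟙 (v zero ≟ t) * ∏ (allFin (suc n)) (λ k → 𝟙 (v′ k <? suc t))
      ≡⟨ cong (𝟙 (v zero ≟ t) *_) (∏-<-⨆ v′ (suc t)) ⟩
    𝟙 (v zero ≟ t) * 𝟙 (⨆ v′ <? suc t) ∎
  at-suc : ∀ i → leftmostMax v t (suc i) ≡ 𝟙 (v zero <? t) * leftmostMax v′ t i
  at-suc i = begin
    leftmostMax v t (suc i)
      ≡⟨ cong₂ (λ x y → (x * 𝟙 (v (suc i) ≟ t)) * y) (∏-allFin-suc (suc n) (before (suc i)))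
                                                     (∏-allFin-suc (suc n) (after (suc i))) ⟩
    ((𝟙 (v zero <? t) * ∏ (allFin (suc n)) (before (suc i) ∘ suc)) * 𝟙 (v (suc i) ≟ t))
      * (1 * ∏ (allFin (suc n)) (after (suc i) ∘ suc))
      ≡⟨ regroup (𝟙 (v zero <? t)) (∏ (allFin (suc n)) (before (suc i) ∘ suc)) (𝟙 (v (suc i) ≟ t))
                 (∏ (allFin (suc n)) (after (suc i) ∘ suc)) ⟩
    𝟙 (v zero <? t) * leftmostMax v′ t i ∎

∑-leftmostMax-filter : ∀ {n} (v : Fin (suc n) → ℕ) t →
  ∑ (allFin (suc n)) (λ i → (∏ (filter (F._<? i) (allFin (suc n))) (λ j → 𝟙 (v j <? t)) * 𝟙 (v i ≟ t))
                              * ∏ (filter (i F.<?_) (allFin (suc n))) (λ k → 𝟙 (v k <? suc t)))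
  ≡ 𝟙 (⨆ v ≟ t)
∑-leftmostMax-filter {n} v t = trans (∑-cong (allFin (suc n)) λ {i} _ →
    cong₂ (λ x y → (x * 𝟙 (v i ≟ t)) * y) (∏-filter (F._<? i) (allFin (suc n)) _) (∏-filter (i F.<?_) (allFin (suc n)) _))
  (∑-leftmostMax v t)

∑-isMax : ∀ {n} (v : Fin (suc n) → ℕ) i (Q? : ∀ j → Dec (¬ j ≡ i)) {T} → v i < T →
  ∑ (upTo T) (λ t → 𝟙 (v i ≟ t) * ∏ (filter Q? (allFin (suc n))) (λ j → 𝟙 (v j <? suc t))) ≡ 𝟙 (v i ≟ ⨆ v)
∑-isMax {n} v i Q? {T} vᵢ<T = begin
  ∑ (upTo T) (λ t → 𝟙 (v i ≟ t) * ∏ (filter Q? (allFin (suc n))) (λ j → 𝟙 (v j <? suc t)))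
    ≡⟨ sift-< (λ t → ∏ (filter Q? (allFin (suc n))) (λ j → 𝟙 (v j <? suc t))) vᵢ<T ⟩
  ∏ (filter Q? (allFin (suc n))) (λ j → 𝟙 (v j <? suc (v i)))
    ≡⟨ ∏-filter-ones Q? (allFin (suc n)) _ (λ j ¬j≢i →
         𝟙-yes (v j <? suc (v i)) (≤-reflexive (cong (suc ∘ v) (decidable-stable (j F.≟ i) ¬j≢i)))) ⟩
  ∏ (allFin (suc n)) (λ j → 𝟙 (v j <? suc (v i)))
    ≡⟨ ∏-<-⨆ v (suc (v i)) ⟩
  𝟙 (⨆ v <? suc (v i))
    ≡⟨ 𝟙-cong (mk⇔ (λ ⨆<1+vᵢ → ≤-antisym (≤-⨆ v i) (s≤s⁻¹ ⨆<1+vᵢ)) (λ vᵢ≡⨆ → s≤s (≤-reflexive (sym vᵢ≡⨆))))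
              (⨆ v <? suc (v i)) (v i ≟ ⨆ v) ⟩
  𝟙 (v i ≟ ⨆ v) ∎
  where open ≡-Reasoning

-- Sets of maximal indices

does≡true⇒ : {P : Set} (d : Dec P) → does d ≡ true → P
does≡true⇒ (yes x) _ = x

∈-tabulate⇔ : ∀ {n} (b : Fin n → Bool) i → i ∈ₛ Vec.tabulate b ⇔ b i ≡ true
∈-tabulate⇔ b i = mk⇔ (λ i∈ → trans (sym (lookup∘tabulate b i)) ([]=⇒lookup i∈))
                      (λ bᵢ → lookup⇒[]= i (Vec.tabulate b) (trans (lookup∘tabulate b i) bᵢ))

∣tabulate∣ : ∀ {n} (b : Fin n → Bool) → ∣ Vec.tabulate b ∣ ≡ ∑ (allFin n) (λ i → if b i then 1 else 0)
∣tabulate∣ {zero} b = refl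
∣tabulate∣ {suc n} b = trans (head-case (b zero)) (sym (∑-allFin-suc n (λ i → if b i then 1 else 0)))
  where
  head-case : ∀ x → ∣ x Vec.∷ Vec.tabulate (b ∘ suc) ∣
                    ≡ (if x then 1 else 0) + ∑ (allFin n) (λ i → if b (suc i) then 1 else 0)
  head-case true = cong suc (∣tabulate∣ (b ∘ suc))
  head-case false = ∣tabulate∣ (b ∘ suc)

argmaxes : ∀ {n} → (Fin (suc n) → ℕ) → Subset (suc n)
argmaxes v = Vec.tabulate (λ i → does (v i ≟ ⨆ v))

∈-argmaxes⇔ : ∀ {n} (v : Fin (suc n) → ℕ) i → i ∈ₛ argmaxes v ⇔ v i ≡ ⨆ v
∈-argmaxes⇔ v i = ⇔.trans (∈-tabulate⇔ (λ j → does (v j ≟ ⨆ v)) i)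
                    (mk⇔ (does≡true⇒ (v i ≟ ⨆ v)) (dec-true (v i ≟ ⨆ v)))

-- The proposition whose indicator is the (I, t) summand of the nummax^(r) formula.
Profile : ∀ {m} → Subset m → (Fin m → ℕ) → ℕ → Set
Profile I v t = ∀ i → (i ∈ₛ I → v i ≡ t) × (¬ i ∈ₛ I → v i < t)

profile⇔ : ∀ {n} (v : Fin (suc n) → ℕ) {I} t → (∃ λ i → i ∈ₛ I) → Profile I v t ⇔ (⨆ v ≡ t × I ≡ argmaxes v)
profile⇔ v {I} t (i₀ , i₀∈I) = mk⇔ to from
  where
  open Equivalence using () renaming (to to ⇒; from to ⇐)
  to : Profile I v t → ⨆ v ≡ t × I ≡ argmaxes v
  to prof = ⨆≡t , ⊆-antisym (λ {i} i∈I → ⇐ (∈-argmaxes⇔ v i) (trans (proj₁ (prof i) i∈I) (sym ⨆≡t)))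
                           (λ {i} i∈M → decidable-stable (i ∈? I) λ i∉I →
                              <-irrefl (trans (⇒ (∈-argmaxes⇔ v i) i∈M) ⨆≡t) (proj₂ (prof i) i∉I))
    where
    i* = proj₁ (⨆-attained v)
    ⨆≡t : ⨆ v ≡ t
    ⨆≡t with i* ∈? I
    ... | yes i*∈I = trans (sym (proj₂ (⨆-attained v))) (proj₁ (prof i*) i*∈I)
    ... | no i*∉I = contradiction (proj₂ (prof i*) i*∉I)
                      (≤⇒≯ (subst₂ _≤_ (proj₁ (prof i₀) i₀∈I) (sym (proj₂ (⨆-attained v))) (≤-⨆ v i₀)))
  from : ⨆ v ≡ t × I ≡ argmaxes v → Profile I v t
  from (refl , refl) i = (⇒ (∈-argmaxes⇔ v i))
                       , (λ i∉M → ≤∧≢⇒< (≤-⨆ v i) (i∉M ∘ ⇐ (∈-argmaxes⇔ v i)))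

∏-profile : ∀ {m} (v : Fin m → ℕ) I (R? : ∀ j → Dec (¬ j ∈ₛ I)) t →
  ∏ (filter (_∈? I) (allFin m)) (λ i → 𝟙 (v i ≟ t)) * ∏ (filter R? (allFin m)) (λ j → 𝟙 (v j <? t))
  ≡ 𝟙 (all? (λ i → (i ∈? I →-dec v i ≟ t) ×-dec (R? i →-dec v i <? t)))
∏-profile {m} v I R? t = begin
  ∏ (filter (_∈? I) (allFin m)) (λ i → 𝟙 (v i ≟ t)) * ∏ (filter R? (allFin m)) (λ j → 𝟙 (v j <? t))
    ≡⟨ cong₂ _*_ (∏-filter (_∈? I) (allFin m) _) (∏-filter R? (allFin m) _) ⟩
  ∏ (allFin m) inI * ∏ (allFin m) outI
    ≡⟨ ∏-* (allFin m) inI outI ⟩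
  ∏ (allFin m) (λ i → inI i * outI i)
    ≡⟨ ∏-cong (allFin m) (λ i → trans (cong₂ _*_ (𝟙-→-dec (i ∈? I) (v i ≟ t)) (𝟙-→-dec (R? i) (v i <? t)))
                                      (𝟙-×-dec (i ∈? I →-dec v i ≟ t) (R? i →-dec v i <? t))) ⟩
  ∏ (allFin m) (λ i → 𝟙 ((i ∈? I →-dec v i ≟ t) ×-dec (R? i →-dec v i <? t)))
    ≡⟨ ∏-𝟙 m (λ i → (i ∈? I →-dec v i ≟ t) ×-dec (R? i →-dec v i <? t)) ⟩
  𝟙 (all? (λ i → (i ∈? I →-dec v i ≟ t) ×-dec (R? i →-dec v i <? t))) ∎
  where
  open ≡-Reasoning
  inI outI : Fin m → ℕ
  inI i = if does (i ∈? I) then 𝟙 (v i ≟ t) else 1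
  outI j = if does (R? j) then 𝟙 (v j <? t) else 1

-- Evaluation in 𝔽_p

module _ (p : ℕ) .{{_ : NonZero p}} where

  [_] : ℕ → Fp p
  [_] = ⟦_⟧ p

  toℕ-[] : ∀ k → toℕ [ k ] ≡ k % p
  toℕ-[] k = toℕ-fromℕ< _

  []-≡ : ∀ {m n} → m % p ≡ n % p → [ m ] ≡ [ n ]
  []-≡ {m} {n} eq = toℕ-injective (trans (toℕ-[] m) (trans eq (sym (toℕ-[] n))))

  [toℕ] : ∀ a → [ toℕ a ] ≡ a
  [toℕ] a = toℕ-injective (trans (toℕ-[] (toℕ a)) (m<n⇒m%n≡m (toℕ<n a)))

  []-+ : ∀ m n → _+F_ p [ m ] [ n ] ≡ [ m + n ]
  []-+ m n = trans (cong₂ (λ a b → [ a + b ]) (toℕ-[] m) (toℕ-[] n)) ([]-≡ (sym (%-distribˡ-+ m n p)))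

  []-* : ∀ m n → _*F_ p [ m ] [ n ] ≡ [ m * n ]
  []-* m n = trans (cong₂ (λ a b → [ a * b ]) (toℕ-[] m) (toℕ-[] n)) ([]-≡ (sym (%-distribˡ-* m n p)))

  χ≡[𝟙] : {P : Set} (d : Dec P) → χ p d ≡ [ 𝟙 d ]
  χ≡[𝟙] (yes _) = refl
  χ≡[𝟙] (no _) = refl

  sumF≡[∑] : ∀ {A : Set} xs {f : A → Fp p} {g : A → ℕ} → (∀ a → f a ≡ [ g a ]) → sumF p xs f ≡ [ ∑ xs g ]
  sumF≡[∑] [] eq = refl
  sumF≡[∑] (a ∷ xs) eq = trans (cong₂ (_+F_ p) (eq a) (sumF≡[∑] xs eq)) ([]-+ _ _)

  [x+[y]%p]%p : ∀ x y → (x + y % p) % p ≡ (x + y) % p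
  [x+[y]%p]%p x y = begin
    (x + y % p) % p          ≡⟨ %-distribˡ-+ x (y % p) p ⟩
    (x % p + y % p % p) % p  ≡⟨ cong (λ z → (x % p + z) % p) (m%n%n≡m%n y p) ⟩
    (x % p + y % p) % p      ≡⟨ %-distribˡ-+ x y p ⟨
    (x + y) % p              ∎
    where open ≡-Reasoning

  toℕ-minus : ∀ (a b : Fp p) → toℕ (_+F_ p a (-F_ p b)) ≡ (toℕ a + (p ∸ toℕ b)) % p
  toℕ-minus a b = trans (toℕ-[] _) (trans (cong (λ z → (toℕ a + z) % p) (toℕ-[] _)) ([x+[y]%p]%p (toℕ a) _))

  toℕ-minus≡0⇔ : ∀ (a b : Fp p) → toℕ (_+F_ p a (-F_ p b)) ≡ 0 ⇔ a ≡ b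
  toℕ-minus≡0⇔ a b = mk⇔ to from
    where
    x = toℕ a
    y = toℕ b
    to : toℕ (_+F_ p a (-F_ p b)) ≡ 0 → a ≡ b
    to eq = toℕ-injective (begin
      x                        ≡⟨ m<n⇒m%n≡m (toℕ<n a) ⟨
      x % p                    ≡⟨ [m+n]%n≡m%n x p ⟨
      (x + p) % p              ≡⟨ cong (λ z → (x + z) % p) (m∸n+n≡m (<⇒≤ (toℕ<n b))) ⟨
      (x + ((p ∸ y) + y)) % p  ≡⟨ cong (_% p) (+-assoc x (p ∸ y) y) ⟨
      ((x + (p ∸ y)) + y) % p  ≡⟨ %-remove-+ˡ y (m%n≡0⇒n∣m _ p (trans (sym (toℕ-minus a b)) eq)) ⟩
      y % p                    ≡⟨ m<n⇒m%n≡m (toℕ<n b) ⟩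
      y                        ∎)
      where open ≡-Reasoning
    from : a ≡ b → toℕ (_+F_ p a (-F_ p b)) ≡ 0
    from refl = trans (toℕ-minus a a) (trans (cong (_% p) (m+[n∸m]≡n (<⇒≤ (toℕ<n a)))) (n%n≡0 p))

  record EvalsTo {m} (e : Expr p m) (ρ : Fin m → Fp p) (a : ℕ) : Set where
    constructor evalsTo
    field eval≡ : eval p e ρ ≡ [ a ]
  open EvalsTo public

  module _ {m} {ρ : Fin m → Fp p} where

    EvalsTo-≡ : ∀ {e a b} → EvalsTo e ρ a → a ≡ b → EvalsTo e ρ b
    EvalsTo-≡ e⇓a refl = e⇓a

    cst-evalsTo : ∀ c → EvalsTo (cst c) ρ (toℕ c)
    cst-evalsTo c = evalsTo (sym ([toℕ] c))

    ⊗-evalsTo : ∀ {e f a b} → EvalsTo e ρ a → EvalsTo f ρ b → EvalsTo (e ⊗ f) ρ (a * b)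
    ⊗-evalsTo (evalsTo e≡) (evalsTo f≡) = evalsTo (trans (cong₂ (_*F_ p) e≡ f≡) ([]-* _ _))

    ΣE-evalsTo : ∀ {A : Set} xs {f : A → Expr p m} {g : A → ℕ} →
                 (∀ {a} → a ∈ˡ xs → EvalsTo (f a) ρ (g a)) → EvalsTo (ΣE p xs f) ρ (∑ xs g)
    ΣE-evalsTo [] _ = evalsTo refl
    ΣE-evalsTo (a ∷ xs) fa⇓ =
      evalsTo (trans (cong₂ (_+F_ p) (eval≡ (fa⇓ (here refl))) (eval≡ (ΣE-evalsTo xs (fa⇓ ∘ there)))) ([]-+ _ _))

    ΠE-evalsTo : ∀ {A : Set} xs {f : A → Expr p m} {g : A → ℕ} →
                 (∀ a → EvalsTo (f a) ρ (g a)) → EvalsTo (ΠE p xs f) ρ (∏ xs g)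
    ΠE-evalsTo [] _ = evalsTo refl
    ΠE-evalsTo (a ∷ xs) fa⇓ = ⊗-evalsTo (fa⇓ a) (ΠE-evalsTo xs fa⇓)

    powE-eval : ∀ e k → eval p (powE p e k) ρ ≡ [ toℕ (eval p e ρ) ^ k ]
    powE-eval e zero = refl
    powE-eval e (suc k) = trans (cong₂ (_*F_ p) (sym ([toℕ] (eval p e ρ))) (powE-eval e k)) ([]-* _ _)

    module _ (p-prime : Prime p) where

      -- With w = x - t, Fermat makes w ^ (p - 1) equal to 1 unless w = 0, where p - 1 ≥ 1 makes it 0.
      δ-eval : ∀ t e → eval p (δ p t e) ρ ≡ [ 𝟙 (eval p e ρ F.≟ t) ]
      δ-eval t e = begin
        eval p (δ p t e) ρ
          ≡⟨ cong (λ z → _+F_ p [ 1 ] (-F_ p z)) (powE-eval (e ⊕ (⊖ cst t)) (p ∸ 1)) ⟩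
        _+F_ p [ 1 ] [ p ∸ toℕ [ w ^ (p ∸ 1) ] ] ≡⟨ []-+ 1 _ ⟩
        [ 1 + (p ∸ toℕ [ w ^ (p ∸ 1) ]) ]     ≡⟨ cong (λ z → [ 1 + (p ∸ z) ]) (toℕ-[] (w ^ (p ∸ 1))) ⟩
        [ 1 + (p ∸ w ^ (p ∸ 1) % p) ]         ≡⟨ by-cases (eval p e ρ F.≟ t) ⟩
        [ 𝟙 (eval p e ρ F.≟ t) ]              ∎
        where
        open ≡-Reasoning
        w = toℕ (eval p (e ⊕ (⊖ cst t)) ρ)
        1<p = nonTrivial⇒n>1 p {{prime⇒nonTrivial p-prime}}
        0%p≡0 : 0 % p ≡ 0
        0%p≡0 = m<n⇒m%n≡m (>-nonZero⁻¹ p)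
        0^-pos : ∀ {k} → 0 < k → 0 ^ k ≡ 0
        0^-pos {suc k} _ = refl
        by-cases : (d : Dec (eval p e ρ ≡ t)) → [ 1 + (p ∸ w ^ (p ∸ 1) % p) ] ≡ [ 𝟙 d ]
        by-cases (yes e≡t) = begin
          [ 1 + (p ∸ w ^ (p ∸ 1) % p) ]
            ≡⟨ cong (λ z → [ 1 + (p ∸ z ^ (p ∸ 1) % p) ]) (Equivalence.from (toℕ-minus≡0⇔ _ t) e≡t) ⟩
          [ 1 + (p ∸ 0 ^ (p ∸ 1) % p) ]  ≡⟨ cong (λ z → [ 1 + (p ∸ z % p) ]) (0^-pos (m<n⇒0<n∸m 1<p)) ⟩
          [ 1 + (p ∸ 0 % p) ]            ≡⟨ []-≡ (trans (cong (λ z → (1 + (p ∸ z)) % p) (0%p≡0)) ([m+n]%n≡m%n 1 p)) ⟩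
          [ 1 ]                          ∎
        by-cases (no e≢t) = begin
          [ 1 + (p ∸ w ^ (p ∸ 1) % p) ]  ≡⟨ cong (λ z → [ 1 + (p ∸ z) ]) (fermat p-prime p∤w) ⟩
          [ 1 + (p ∸ 1) ]                ≡⟨ cong [_] (m+[n∸m]≡n (<⇒≤ 1<p)) ⟩
          [ p ]                          ≡⟨ []-≡ (trans (n%n≡0 p) (sym (0%p≡0))) ⟩
          [ 0 ]                          ∎
          where
          p∤w : ¬ p ∣ w
          p∤w p∣w = e≢t (Equivalence.to (toℕ-minus≡0⇔ _ t) (small (toℕ<n _) p∣w))
            where
            small : ∀ {u} → u < p → p ∣ u → u ≡ 0
            small {zero} _ _ = refl
            small {suc u} u<p p∣u = contradiction p∣u (>⇒∤ u<p)

      δ-evalsTo : ∀ {t} e → t < p → EvalsTo (δ p [ t ] e) ρ (𝟙 (toℕ (eval p e ρ) ≟ t))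
      δ-evalsTo {t} e t<p =
        evalsTo (trans (δ-eval [ t ] e) (cong [_] (𝟙-cong eqs (eval p e ρ F.≟ [ t ]) (toℕ (eval p e ρ) ≟ t))))
        where
        toℕ[t]≡t : toℕ [ t ] ≡ t
        toℕ[t]≡t = trans (toℕ-[] t) (m<n⇒m%n≡m t<p)
        eqs : eval p e ρ ≡ [ t ] ⇔ toℕ (eval p e ρ) ≡ t
        eqs = mk⇔ (λ eq → trans (cong toℕ eq) toℕ[t]≡t) (λ eq → toℕ-injective (trans eq (sym toℕ[t]≡t)))

      L-evalsTo : ∀ {t} e → t ≤ p → EvalsTo (L p t e) ρ (𝟙 (toℕ (eval p e ρ) <? t))
      L-evalsTo {t} e t≤p = EvalsTo-≡ (ΣE-evalsTo (upTo t) (λ k∈ → δ-evalsTo e (≤-trans (∈-upTo⁻ k∈) t≤p)))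
        (begin
          ∑ (upTo t) (λ k → 𝟙 (c ≟ k))      ≡⟨ ∑-cong (upTo t) (λ _ → sym (*-identityʳ _)) ⟩
          ∑ (upTo t) (λ k → 𝟙 (c ≟ k) * 1)  ≡⟨ sift t c (λ _ → 1) ⟩
          𝟙 (c <? t) * 1                    ≡⟨ *-identityʳ _ ⟩
          𝟙 (c <? t)                        ∎)
        where
        open ≡-Reasoning
        c = toℕ (eval p e ρ)

  toℕ-maxAll : ∀ {n} (x : Fin (suc n) → Fp p) → toℕ (maxAll p x) ≡ ⨆ (toℕ ∘ x)
  toℕ-maxAll {zero} x = refl
  toℕ-maxAll {suc n} x =
    trans (toℕ-maxF (x zero) (maxAll p (x ∘ suc))) (cong (toℕ (x zero) ⊔_) (toℕ-maxAll (x ∘ suc)))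
    where
    toℕ-maxF : ∀ a b → toℕ (maxF p a b) ≡ toℕ a ⊔ toℕ b
    toℕ-maxF a b with toℕ a ≤? toℕ b
    ... | yes a≤b = sym (m≤n⇒m⊔n≡n a≤b)
    ... | no a≰b = sym (m≥n⇒m⊔n≡m (≰⇒≥ a≰b))

  ≡maxAll⇔ : ∀ {n} (x : Fin (suc n) → Fp p) y → y ≡ maxAll p x ⇔ toℕ y ≡ ⨆ (toℕ ∘ x)
  ≡maxAll⇔ x y = mk⇔ (λ eq → trans (cong toℕ eq) (toℕ-maxAll x))
                     (λ eq → toℕ-injective (trans eq (sym (toℕ-maxAll x))))

  numMaxCount≡∑ : ∀ {n} (x : Fin (suc n) → Fp p) →
                  numMaxCount p x ≡ ∑ (allFin (suc n)) (λ i → 𝟙 (toℕ (x i) ≟ ⨆ (toℕ ∘ x)))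
  numMaxCount≡∑ {n} x = trans (length-filter≡∑𝟙 (λ i → x i F.≟ maxAll p x) (allFin (suc n)))
    (∑-cong (allFin (suc n)) λ {i} _ → 𝟙-cong (≡maxAll⇔ x (x i)) (x i F.≟ maxAll p x) (toℕ (x i) ≟ ⨆ (toℕ ∘ x)))

  numMaxCount-bounds : ∀ {n} (x : Fin (suc n) → Fp p) → 1 ≤ numMaxCount p x × numMaxCount p x ≤ suc n
  numMaxCount-bounds {n} x =
      nonempty (∈-filter⁺ (λ i → x i F.≟ maxAll p x) (∈-allFin i*) (proj₂ max-attained))
    , ≤-trans (length-filter (λ i → x i F.≟ maxAll p x) (allFin (suc n))) (≤-reflexive (length-tabulate (λ i → i)))
    where
    max-attained : ∃ λ i → x i ≡ maxAll p x
    max-attained = let (i , eq) = ⨆-attained (toℕ ∘ x) in i , Equivalence.from (≡maxAll⇔ x (x i)) eq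
    i* = proj₁ max-attained
    nonempty : ∀ {A : Set} {a : A} {xs} → a ∈ˡ xs → 1 ≤ length xs
    nonempty (here _) = s≤s z≤n
    nonempty (there _) = s≤s z≤n

  ∑-allSubsets-single : ∀ n (S : Subset n) (f : Subset n → ℕ) → (∀ I → I ≢ S → f I ≡ 0) → ∑ (allSubsets p n) f ≡ f S
  ∑-allSubsets-single zero Vec.[] f _ = +-identityʳ (f Vec.[])
  ∑-allSubsets-single (suc n) (s Vec.∷ S) f vanish = begin
    ∑ (map (outside Vec.∷_) (allSubsets p n) ++ map (inside Vec.∷_) (allSubsets p n)) f
      ≡⟨ ∑-++ (map (outside Vec.∷_) (allSubsets p n)) _ f ⟩
    ∑ (map (outside Vec.∷_) (allSubsets p n)) f + ∑ (map (inside Vec.∷_) (allSubsets p n)) f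
      ≡⟨ cong₂ _+_ (∑-map (outside Vec.∷_) (allSubsets p n) f) (∑-map (inside Vec.∷_) (allSubsets p n) f) ⟩
    ∑ (allSubsets p n) (f ∘ (outside Vec.∷_)) + ∑ (allSubsets p n) (f ∘ (inside Vec.∷_))
      ≡⟨ by-head s vanish ⟩
    f (s Vec.∷ S) ∎
    where
    open ≡-Reasoning
    rest : ∀ x → (∀ I → I ≢ x Vec.∷ S → f I ≡ 0) → ∑ (allSubsets p n) (f ∘ (x Vec.∷_)) ≡ f (x Vec.∷ S)
    rest x vanish′ = ∑-allSubsets-single n S (f ∘ (x Vec.∷_)) (λ I I≢S → vanish′ (x Vec.∷ I) (I≢S ∘ ∷-injectiveʳ))
    other : ∀ x y → x ≢ y → (∀ I → I ≢ y Vec.∷ S → f I ≡ 0) → ∑ (allSubsets p n) (f ∘ (x Vec.∷_)) ≡ 0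
    other x y x≢y vanish′ = ∑-zero (allSubsets p n) (λ I → vanish′ (x Vec.∷ I) (x≢y ∘ ∷-injectiveˡ))
    by-head : ∀ s → (∀ I → I ≢ s Vec.∷ S → f I ≡ 0) →
              ∑ (allSubsets p n) (f ∘ (outside Vec.∷_)) + ∑ (allSubsets p n) (f ∘ (inside Vec.∷_)) ≡ f (s Vec.∷ S)
    by-head false vanish′ = trans (cong₂ _+_ (rest false vanish′) (other true false (λ ()) vanish′)) (+-identityʳ _)
    by-head true vanish′ = cong₂ _+_ (other false true (λ ()) vanish′) (rest true vanish′)

  -- Only the set of maximal indices, at the level of the maximum, contributes.
  ∑-subsetsOfSize : ∀ {n} (v : Fin (suc n) → ℕ) (R? : ∀ I j → Dec (¬ j ∈ₛ I)) {k T} → 1 ≤ k → ⨆ v < T →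
    ∑ (subsetsOfSize p (suc n) k) (λ I → ∑ (upTo T) λ t →
        ∏ (filter (_∈? I) (allFin (suc n))) (λ i → 𝟙 (v i ≟ t)) * ∏ (filter (R? I) (allFin (suc n))) (λ j → 𝟙 (v j <? t)))
    ≡ 𝟙 (∣ argmaxes v ∣ ≟ k)
  ∑-subsetsOfSize {n} v R? {k} {T} 1≤k ⨆<T = begin
    ∑ (subsetsOfSize p (suc n) k) (λ I → ∑ (upTo T) (summand I))
      ≡⟨ ∑-cong (subsetsOfSize p (suc n) k) (λ {I} I∈ →
           ∑-summand {I} (proj₂ (∈-filter⁻ (λ J → ∣ J ∣ ≟ k) {xs = allSubsets p (suc n)} I∈))) ⟩
    ∑ (subsetsOfSize p (suc n) k) (λ I → 𝟙 (I ≟ₛ M))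
      ≡⟨ ∑-filter (λ I → ∣ I ∣ ≟ k) (allSubsets p (suc n)) (λ I → 𝟙 (I ≟ₛ M)) ⟩
    ∑ (allSubsets p (suc n)) (λ I → 𝟙 (∣ I ∣ ≟ k) * 𝟙 (I ≟ₛ M))
      ≡⟨ ∑-allSubsets-single (suc n) M (λ I → 𝟙 (∣ I ∣ ≟ k) * 𝟙 (I ≟ₛ M)) (λ I I≢M →
           trans (cong (𝟙 (∣ I ∣ ≟ k) *_) (𝟙-no (I ≟ₛ M) I≢M)) (*-zeroʳ (𝟙 (∣ I ∣ ≟ k)))) ⟩
    𝟙 (∣ M ∣ ≟ k) * 𝟙 (M ≟ₛ M)
      ≡⟨ trans (cong (𝟙 (∣ M ∣ ≟ k) *_) (𝟙-yes (M ≟ₛ M) refl)) (*-identityʳ _) ⟩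
    𝟙 (∣ M ∣ ≟ k) ∎
    where
    open ≡-Reasoning
    M = argmaxes v
    _≟ₛ_ : (I J : Subset (suc n)) → Dec (I ≡ J)
    _≟ₛ_ = ≡-dec Bool._≟_
    summand : Subset (suc n) → ℕ → ℕ
    summand I t =
      ∏ (filter (_∈? I) (allFin (suc n))) (λ i → 𝟙 (v i ≟ t)) * ∏ (filter (R? I) (allFin (suc n))) (λ j → 𝟙 (v j <? t))
    ∑-summand : ∀ {I} → ∣ I ∣ ≡ k → ∑ (upTo T) (summand I) ≡ 𝟙 (I ≟ₛ M)
    ∑-summand {I} ∣I∣≡k = begin
      ∑ (upTo T) (summand I)
        ≡⟨ ∑-cong (upTo T) (λ {t} _ → trans (∏-profile v I (R? I) t) (trans
             (𝟙-cong (profile⇔ v t nonempty) (all? (λ i → (i ∈? I →-dec v i ≟ t) ×-dec (R? I i →-dec v i <? t)))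
                                             ((⨆ v ≟ t) ×-dec (I ≟ₛ M)))
             (sym (𝟙-×-dec (⨆ v ≟ t) (I ≟ₛ M))))) ⟩
      ∑ (upTo T) (λ t → 𝟙 (⨆ v ≟ t) * 𝟙 (I ≟ₛ M))
        ≡⟨ sift-< (λ _ → 𝟙 (I ≟ₛ M)) ⨆<T ⟩
      𝟙 (I ≟ₛ M) ∎
      where
      nonempty : Nonempty I
      nonempty = decidable-stable (nonempty? I) λ empty →
        m<n⇒n≢0 (subst (1 ≤_) (sym ∣I∣≡k) 1≤k) (trans (cong ∣_∣ (Empty-unique empty)) (∣⊥∣≡0 (suc n)))

  [∑digits]≡nummax : ∀ {n} r (x : Fin (suc n) → Fp p) →
    [ ∑ (map suc (upTo (suc n))) (λ k → toℕ (digit p r k) * 𝟙 (numMaxCount p x ≟ k)) ] ≡ nummax p r x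
  [∑digits]≡nummax {n} r x = trans (cong [_] (sift-suc (suc n) (toℕ ∘ digit p r) 1≤count count≤n)) ([toℕ] _)
    where
    1≤count = proj₁ (numMaxCount-bounds x)
    count≤n = proj₂ (numMaxCount-bounds x)

  nummax≡∑digits : ∀ {n} r (x : Fin (suc n) → Fp p) →
    nummax p r x ≡ sumF p (map suc (upTo (suc n))) (λ k → _*F_ p (digit p r k) (χ p (numMaxCount p x ≟ k)))
  nummax≡∑digits {n} r x = sym (trans
    (sumF≡[∑] (map suc (upTo (suc n))) (λ k →
      trans (cong₂ (_*F_ p) (sym ([toℕ] (digit p r k))) (χ≡[𝟙] (numMaxCount p x ≟ k))) ([]-* _ _)))
    ([∑digits]≡nummax r x))

  nummax0≡∑χ : ∀ {n} (x : Fin (suc n) → Fp p) →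
               nummax p 0 x ≡ sumF p (allFin (suc n)) (λ i → χ p (maxAll p x F.≟ x i))
  nummax0≡∑χ {n} x = begin
    [ numMaxCount p x ]
      ≡⟨ cong [_] (length-filter≡∑𝟙 (λ i → x i F.≟ maxAll p x) (allFin (suc n))) ⟩
    [ ∑ (allFin (suc n)) (λ i → 𝟙 (x i F.≟ maxAll p x)) ]
      ≡⟨ cong [_] (∑-cong (allFin (suc n)) λ {i} _ → 𝟙-cong (mk⇔ sym sym) (x i F.≟ maxAll p x) (maxAll p x F.≟ x i)) ⟩
    [ ∑ (allFin (suc n)) (λ i → 𝟙 (maxAll p x F.≟ x i)) ]
      ≡⟨ sumF≡[∑] (allFin (suc n)) (λ i → χ≡[𝟙] (maxAll p x F.≟ x i)) ⟨
    sumF p (allFin (suc n)) (λ i → χ p (maxAll p x F.≟ x i)) ∎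
    where open ≡-Reasoning

  module _ (p-prime : Prime p) where

    ismaxExpr-eval : ∀ n (ρ : Fin (2 + n) → Fp p) → eval p (ismaxExpr p (suc n)) ρ ≡ ismax p (ρ zero) (ρ ∘ suc)
    ismaxExpr-eval n ρ = begin
      eval p (ismaxExpr p (suc n)) ρ
        ≡⟨ eval≡ (ΣE-evalsTo (upTo p) λ t∈ → ⊗-evalsTo (δ-evalsTo p-prime (var zero) (∈-upTo⁻ t∈))
             (EvalsTo-≡ (ΣE-evalsTo (allFin (suc n)) λ {i} _ →
               ⊗-evalsTo (⊗-evalsTo (ΠE-evalsTo (filter (F._<? i) (allFin (suc n))) λ j →
                                       L-evalsTo p-prime (var (suc j)) (<⇒≤ (∈-upTo⁻ t∈)))
                                    (δ-evalsTo p-prime (var (suc i)) (∈-upTo⁻ t∈)))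
                         (ΠE-evalsTo (filter (i F.<?_) (allFin (suc n))) λ k →
                            L-evalsTo p-prime (var (suc k)) (∈-upTo⁻ t∈)))
               (∑-leftmostMax-filter v _))) ⟩
      [ ∑ (upTo p) (λ t → 𝟙 (c ≟ t) * 𝟙 (⨆ v ≟ t)) ] ≡⟨ cong [_] (sift-< (λ t → 𝟙 (⨆ v ≟ t)) (toℕ<n y)) ⟩
      [ 𝟙 (⨆ v ≟ c) ]                                 ≡⟨ cong [_] (𝟙-cong max≡y⇔ (⨆ v ≟ c) (maxAll p x F.≟ y)) ⟩
      [ 𝟙 (maxAll p x F.≟ y) ]                        ≡⟨ χ≡[𝟙] (maxAll p x F.≟ y) ⟨
      ismax p y x ∎
      where
      open ≡-Reasoning
      x = ρ ∘ suc
      y = ρ zero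
      v = toℕ ∘ x
      c = toℕ y
      max≡y⇔ : ⨆ v ≡ c ⇔ maxAll p x ≡ y
      max≡y⇔ = mk⇔ (sym ∘ Equivalence.from (≡maxAll⇔ x y) ∘ sym) (sym ∘ Equivalence.to (≡maxAll⇔ x y) ∘ sym)

    -- The next two lemmas abstract over the number of variables and over the decision
    -- procedures inside the filters: those procedures are local to Defs, so they can only
    -- be matched by unification, which needs allFin N to stay unevaluated.
    nummax0Expr-evalsTo : ∀ {N} (x : Fin N → Fp p) (V : Fin N → ℕ) →
      (∀ i (Q? : ∀ j → Dec (¬ j ≡ i)) →
        ∑ (upTo p) (λ t → 𝟙 (toℕ (x i) ≟ t) * ∏ (filter Q? (allFin N)) (λ j → 𝟙 (toℕ (x j) <? suc t))) ≡ V i) →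
      EvalsTo (nummax0Expr p N) x (∑ (allFin N) V)
    nummax0Expr-evalsTo {N} x V summand≡ = ΣE-evalsTo (allFin N) λ {i} _ → EvalsTo-≡
      (ΣE-evalsTo (upTo p) λ t∈ → ⊗-evalsTo (δ-evalsTo p-prime (var i) (∈-upTo⁻ t∈))
        (ΠE-evalsTo (filter _ (allFin N)) λ j → L-evalsTo p-prime (var j) (∈-upTo⁻ t∈)))
      (summand≡ i _)

    nummax0Expr-eval : ∀ n (x : Fin (suc n) → Fp p) → eval p (nummax0Expr p (suc n)) x ≡ nummax p 0 x
    nummax0Expr-eval n x = begin
      eval p (nummax0Expr p (suc n)) x
        ≡⟨ eval≡ (nummax0Expr-evalsTo x _ λ i Q? → ∑-isMax v i Q? (toℕ<n (x i))) ⟩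
      [ ∑ (allFin (suc n)) (λ i → 𝟙 (v i ≟ ⨆ v)) ] ≡⟨ cong [_] (numMaxCount≡∑ x) ⟨
      [ numMaxCount p x ] ∎
      where
      open ≡-Reasoning
      v = toℕ ∘ x

    nummaxExpr-evalsTo : ∀ {N} r (x : Fin N → Fp p) (W : ℕ → ℕ) →
      (∀ {k} → k ∈ˡ map suc (upTo N) → (R? : ∀ I j → Dec (¬ j ∈ₛ I)) →
        ∑ (subsetsOfSize p N k) (λ I → ∑ (upTo p) λ t →
          ∏ (filter (_∈? I) (allFin N)) (λ i → 𝟙 (toℕ (x i) ≟ t)) * ∏ (filter (R? I) (allFin N)) (λ j → 𝟙 (toℕ (x j) <? t)))
        ≡ W k) →
      EvalsTo (nummaxExpr p N r) x (∑ (map suc (upTo N)) (λ k → toℕ (digit p r k) * W k))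
    nummaxExpr-evalsTo {N} r x W summand≡ =
      ΣE-evalsTo (map suc (upTo N)) λ {k} k∈ → ⊗-evalsTo (cst-evalsTo (digit p r k))
      (EvalsTo-≡ (ΣE-evalsTo (subsetsOfSize p N k) λ {I} _ → ΣE-evalsTo (upTo p) λ t∈ →
          ⊗-evalsTo (ΠE-evalsTo (filter (_∈? I) (allFin N)) λ i → δ-evalsTo p-prime (var i) (∈-upTo⁻ t∈))
                    (ΠE-evalsTo (filter _ (allFin N)) λ j → L-evalsTo p-prime (var j) (<⇒≤ (∈-upTo⁻ t∈))))
        (summand≡ k∈ _))

    nummaxExpr-eval : ∀ n r (x : Fin (suc n) → Fp p) → eval p (nummaxExpr p (suc n) r) x ≡ nummax p r x
    nummaxExpr-eval n r x = begin
      eval p (nummaxExpr p (suc n) r) x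
        ≡⟨ eval≡ (nummaxExpr-evalsTo r x _ λ k∈ R? →
             trans (∑-subsetsOfSize v R? (positive k∈) ⨆<p) (cong (λ m → 𝟙 (m ≟ _)) ∣argmaxes∣≡count)) ⟩
      [ ∑ (map suc (upTo (suc n))) (λ k → toℕ (digit p r k) * 𝟙 (numMaxCount p x ≟ k)) ]
        ≡⟨ [∑digits]≡nummax r x ⟩
      nummax p r x ∎
      where
      open ≡-Reasoning
      v = toℕ ∘ x
      ⨆<p : ⨆ v < p
      ⨆<p = subst (_< p) (toℕ-maxAll x) (toℕ<n (maxAll p x))
      ∣argmaxes∣≡count : ∣ argmaxes v ∣ ≡ numMaxCount p x
      ∣argmaxes∣≡count = trans (∣tabulate∣ (λ i → does (v i ≟ ⨆ v))) (sym (numMaxCount≡∑ x))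
      positive : ∀ {k} → k ∈ˡ map suc (upTo (suc n)) → 1 ≤ k
      positive k∈ with ∈-map⁻ suc k∈
      ... | _ , _ , refl = s≤s z≤n

  -- Degree bounds

  record Bounded {m} (E : Expr p m) (b : Fin m → ℕ) : Set where
    constructor bounded
    field monomials≤ : All (λ (_ , u) → ∀ i → Vec.lookup u i ≤ b i) (expand p E)

  module _ {m : ℕ} where

    Bounded-mono : ∀ {E : Expr p m} {b b′} → (∀ i → b i ≤ b′ i) → Bounded E b → Bounded E b′
    Bounded-mono b≤b′ (bounded E≤b) = bounded (All.map (λ u≤b i → ≤-trans (u≤b i) (b≤b′ i)) E≤b)

    Bounded-cst : ∀ c (b : Fin m → ℕ) → Bounded (cst c) b
    Bounded-cst c b = bounded ((λ i → subst (_≤ b i) (sym (lookup-replicate i 0)) z≤n) ∷ [])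

    Bounded-var : ∀ (i : Fin m) → Bounded (var i) (λ j → 𝟙 (i F.≟ j))
    Bounded-var i = bounded ((λ j → ≤-reflexive (trans (lookup∘tabulate (λ k → if ⌊ i F.≟ k ⌋ then 1 else 0) j)
                                                      (cong (λ b → if b then 1 else 0) (isYes≗does (i F.≟ j))))) ∷ [])

    Bounded-⊕ : ∀ {e f : Expr p m} {b} → Bounded e b → Bounded f b → Bounded (e ⊕ f) b
    Bounded-⊕ (bounded e≤b) (bounded f≤b) = bounded (++⁺ e≤b f≤b)

    Bounded-⊖ : ∀ {e : Expr p m} {b} → Bounded e b → Bounded (⊖ e) b
    Bounded-⊖ (bounded e≤b) = bounded (map⁺ e≤b)

    Bounded-⊗ : ∀ {e f : Expr p m} {b b′} → Bounded e b → Bounded f b′ → Bounded (e ⊗ f) (λ i → b i + b′ i)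
    Bounded-⊗ {b = b} {b′} (bounded e≤b) (bounded f≤b′) =
      bounded (concat⁺ (map⁺ (All.map (λ {(_ , u)} u≤b → map⁺ (All.map (λ {(_ , u′)} u′≤b′ i →
        subst (_≤ b i + b′ i) (sym (lookup-zipWith _+_ i u u′)) (+-mono-≤ (u≤b i) (u′≤b′ i))) f≤b′)) e≤b)))

    Bounded-powE : ∀ {e : Expr p m} {b} k → Bounded e b → Bounded (powE p e k) (λ i → k * b i)
    Bounded-powE zero _ = Bounded-cst (1F p) _
    Bounded-powE (suc k) e≤b = Bounded-⊗ e≤b (Bounded-powE k e≤b)

    Bounded-ΣE : ∀ {A : Set} xs {f : A → Expr p m} {b} → (∀ a → Bounded (f a) b) → Bounded (ΣE p xs f) b
    Bounded-ΣE [] _ = Bounded-cst (0F p) _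
    Bounded-ΣE (a ∷ xs) fa≤b = Bounded-⊕ (fa≤b a) (Bounded-ΣE xs fa≤b)

    Bounded-ΠE : ∀ {A : Set} xs {f : A → Expr p m} {b : A → Fin m → ℕ} →
                 (∀ a → Bounded (f a) (b a)) → Bounded (ΠE p xs f) (λ i → ∑ xs (λ a → b a i))
    Bounded-ΠE [] _ = Bounded-cst (1F p) _
    Bounded-ΠE (a ∷ xs) fa≤b = Bounded-⊗ (fa≤b a) (Bounded-ΠE xs fa≤b)

  Bounded⇒Reduced : ∀ {m} {E : Expr p m} {b} → (∀ i → b i < p) → Bounded E b → Reduced p E
  Bounded⇒Reduced {E = E} {b} b<p (bounded E≤b) ex i p≤exᵢ = no-match (expand p E) E≤b
    where
    0F+0F : _+F_ p (0F p) (0F p) ≡ 0F p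
    0F+0F = []-+ 0 0
    no-match : ∀ monos → All (λ (_ , u) → ∀ i → Vec.lookup u i ≤ b i) monos →
               sumF p monos (λ { (a , u) → if ⌊ ≡-dec _≟_ u ex ⌋ then a else 0F p }) ≡ 0F p
    no-match [] [] = refl
    no-match ((a , u) ∷ monos) (u≤b ∷ monos≤b) = head≡0 (≡-dec _≟_ u ex)
      where
      head≡0 : (d : Dec (u ≡ ex)) → _+F_ p (if ⌊ d ⌋ then a else 0F p) (sumF p monos _) ≡ 0F p
      head≡0 (yes refl) = contradiction (≤-<-trans (u≤b i) (b<p i)) (≤⇒≯ p≤exᵢ)
      head≡0 (no _) = trans (cong (_+F_ p (0F p)) (no-match monos monos≤b)) 0F+0F

  -- Each factor δ_t(x_i) or L_t(x_i) has degree p - 1 in x_i; c i counts the factors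
  -- of a product that involve x_i.
  OccursAtMost : ∀ {m} → Expr p m → (Fin m → ℕ) → Set
  OccursAtMost E c = Bounded E (λ i → (p ∸ 1) * c i)

  module _ {m : ℕ} where

    OccursAtMost-mono : ∀ {E : Expr p m} {c c′} → (∀ i → c i ≤ c′ i) → OccursAtMost E c → OccursAtMost E c′
    OccursAtMost-mono c≤c′ = Bounded-mono (λ i → *-monoʳ-≤ (p ∸ 1) (c≤c′ i))

    OccursAtMost-⊗ : ∀ {e f : Expr p m} {c c′} →
                     OccursAtMost e c → OccursAtMost f c′ → OccursAtMost (e ⊗ f) (λ i → c i + c′ i)
    OccursAtMost-⊗ {c = c} {c′} e≤c f≤c′ =
      Bounded-mono (λ i → ≤-reflexive (sym (*-distribˡ-+ (p ∸ 1) (c i) (c′ i)))) (Bounded-⊗ e≤c f≤c′)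

    OccursAtMost-ΠE : ∀ {A : Set} xs {f : A → Expr p m} {c : A → Fin m → ℕ} →
                      (∀ a → OccursAtMost (f a) (c a)) → OccursAtMost (ΠE p xs f) (λ i → ∑ xs (λ a → c a i))
    OccursAtMost-ΠE xs {c = c} fa≤c =
      Bounded-mono (λ i → ≤-reflexive (∑-*ˡ xs (p ∸ 1) (λ a → c a i))) (Bounded-ΠE xs fa≤c)

    OccursAtMost-δ : ∀ t (i : Fin m) → OccursAtMost (δ p t (var i)) (λ j → 𝟙 (i F.≟ j))
    OccursAtMost-δ t i =
      Bounded-⊕ (Bounded-cst (1F p) _) (Bounded-⊖ (Bounded-powE (p ∸ 1) (Bounded-⊕ (Bounded-var i) (Bounded-⊖ (Bounded-cst t _)))))

    OccursAtMost-L : ∀ t (i : Fin m) → OccursAtMost (L p t (var i)) (λ j → 𝟙 (i F.≟ j))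
    OccursAtMost-L t i = Bounded-ΣE (upTo t) (λ k → OccursAtMost-δ _ i)

    OccursAtMost⇒Reduced : ∀ {E : Expr p m} {c} → (∀ i → c i ≤ 1) → OccursAtMost E c → Reduced p E
    OccursAtMost⇒Reduced c≤1 = Bounded⇒Reduced (λ i → ≤-<-trans (*-monoʳ-≤ (p ∸ 1) (c≤1 i))
      (subst (_< p) (sym (*-identityʳ (p ∸ 1))) (∸-monoʳ-< z<s (>-nonZero⁻¹ p))))

  ismaxExpr-reduced : ∀ n → Reduced p (ismaxExpr p (suc n))
  ismaxExpr-reduced n = OccursAtMost⇒Reduced (λ _ → ≤-refl) (Bounded-ΣE (tRange p) λ t →
    OccursAtMost-mono y-or-x (OccursAtMost-⊗ (OccursAtMost-δ [ t ] zero) (Bounded-ΣE (allFin (suc n)) λ i →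
      OccursAtMost-mono (uses≤ i)
        (OccursAtMost-⊗ (OccursAtMost-⊗ (OccursAtMost-ΠE (filter (F._<? i) (allFin (suc n))) λ j →
                                           OccursAtMost-L t (suc j))
                                        (OccursAtMost-δ [ t ] (suc i)))
                        (OccursAtMost-ΠE (filter (i F.<?_) (allFin (suc n))) λ k →
                           OccursAtMost-L (suc t) (suc k))))))
    where
    onlyX : Fin (2 + n) → ℕ
    onlyX zero = 0
    onlyX (suc _) = 1
    y-or-x : ∀ w → 𝟙 (zero F.≟ w) + onlyX w ≤ 1
    y-or-x zero = ≤-refl
    y-or-x (suc _) = ≤-refl
    uses≤ : ∀ i w → (∑ (filter (F._<? i) (allFin (suc n))) (λ j → 𝟙 (suc j F.≟ w)) + 𝟙 (suc i F.≟ w))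
                     + ∑ (filter (i F.<?_) (allFin (suc n))) (λ k → 𝟙 (suc k F.≟ w)) ≤ onlyX w
    uses≤ i zero = ≤-reflexive (cong₂ _+_ (cong (_+ 0) (∑-zero (filter (F._<? i) (allFin (suc n))) λ _ → refl))
                                         (∑-zero (filter (i F.<?_) (allFin (suc n))) λ _ → refl))
    uses≤ i (suc w) = ≤-reflexive (trans
      (cong₂ (λ a b → a + 𝟙 (i F.≟ w) + b) (∑-filter-𝟙≟ (F._<? i) w) (∑-filter-𝟙≟ (i F.<?_) w))
      (𝟙-trichotomy i w))

  nummax0Expr-reduced : ∀ N → Reduced p (nummax0Expr p N)
  nummax0Expr-reduced N = OccursAtMost⇒Reduced (λ _ → ≤-refl)
    (Bounded-ΣE (allFin N) λ i → Bounded-ΣE (tRange p) λ t → OccursAtMost-mono (uses≤ i _)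
      (OccursAtMost-⊗ (OccursAtMost-δ [ t ] i) (OccursAtMost-ΠE (filter _ (allFin N)) λ j → OccursAtMost-L (suc t) j)))
    where
    uses≤ : ∀ i (Q? : ∀ j → Dec (¬ j ≡ i)) w → 𝟙 (i F.≟ w) + ∑ (filter Q? (allFin N)) (λ j → 𝟙 (j F.≟ w)) ≤ 1
    uses≤ i Q? w = ≤-trans (≤-reflexive (cong (𝟙 (i F.≟ w) +_) (∑-filter-𝟙≟ Q? w))) (by-cases (i F.≟ w))
      where
      by-cases : (d : Dec (i ≡ w)) → 𝟙 d + 𝟙 (Q? w) ≤ 1
      by-cases (yes refl) = ≤-reflexive (cong suc (𝟙-no (Q? i) (λ i≢i → i≢i refl)))
      by-cases (no _) = 𝟙≤1 (Q? w)

  nummaxExpr-reduced : ∀ N r → Reduced p (nummaxExpr p N r)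
  nummaxExpr-reduced N r = OccursAtMost⇒Reduced (λ _ → ≤-refl) (Bounded-ΣE (map suc (upTo N)) λ k →
    OccursAtMost-⊗ {c = λ _ → 0} (Bounded-cst (digit p r k) _)
      (Bounded-ΣE (subsetsOfSize p N k) λ I → Bounded-ΣE (tRange p) λ t → OccursAtMost-mono (uses≤ I _)
        (OccursAtMost-⊗ (OccursAtMost-ΠE (filter (_∈? I) (allFin N)) λ i → OccursAtMost-δ [ t ] i)
                        (OccursAtMost-ΠE (filter _ (allFin N)) λ j → OccursAtMost-L t j))))
    where
    uses≤ : ∀ I (R? : ∀ j → Dec (¬ j ∈ₛ I)) w →
            ∑ (filter (_∈? I) (allFin N)) (λ i → 𝟙 (i F.≟ w)) + ∑ (filter R? (allFin N)) (λ j → 𝟙 (j F.≟ w)) ≤ 1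
    uses≤ I R? w = ≤-trans (≤-reflexive (cong₂ _+_ (∑-filter-𝟙≟ (_∈? I) w) (∑-filter-𝟙≟ R? w))) (by-cases (w ∈? I))
      where
      by-cases : (d : Dec (w ∈ₛ I)) → 𝟙 d + 𝟙 (R? w) ≤ 1
      by-cases (yes w∈I) = ≤-reflexive (cong suc (𝟙-no (R? w) (λ w∉I → w∉I w∈I)))
      by-cases (no _) = 𝟙≤1 (R? w)

proposition6p1 : (p : ℕ) .{{_ : NonZero p}} → Prime p → (n : ℕ) →
    IsMinimalPolyExpr p (ismaxExpr p (suc n)) (λ ρ → ismax p (ρ zero) (ρ ∘ suc))
    × ((x : Fin (suc n) → Fp p) →
        nummax p 0 x ≡ sumF p (allFin (suc n)) (λ i → χ p (maxAll p x F.≟ x i)))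
    × IsMinimalPolyExpr p (nummax0Expr p (suc n)) (nummax p 0)
    × ((r : ℕ) →
        ((x : Fin (suc n) → Fp p) →
          nummax p r x ≡ sumF p (map suc (upTo (suc n)))
            (λ k → _*F_ p (digit p r k) (χ p (numMaxCount p x ℕ.≟ k))))
        × IsMinimalPolyExpr p (nummaxExpr p (suc n) r) (nummax p r))
proposition6p1 p p-prime n =
    (ismaxExpr-eval p p-prime n , ismaxExpr-reduced p n)
  , nummax0≡∑χ p
  , (nummax0Expr-eval p p-prime n , nummax0Expr-reduced p (suc n))
  , λ r → nummax≡∑digits p r , (nummaxExpr-eval p p-prime n r , nummaxExpr-reduced p (suc n) r)
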